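{- Let $R$ be any one of the following eight subsets of $\{0,1,2,3\}^2$: (A25) $\{(0,0),(0,1),(0,2),(1,1),(1,2),(3,0),(3,1),(3,2)\}$; (A26) $\{(1,0),(2,0),(3,0),(1,1),(2,1),(1,3),(2,3),(3,3)\}$; (A27) $\{(0,1),(0,2),(0,3),(2,1),(2,2),(3,1),(3,2),(3,3)\}$; (A28) $\{(0,1),(0,2),(0,3),(1,1),(1,2),(3,1),(3,2),(3,3)\}$; (A29) $\{(0,0),(1,0),(2,0),(1,2),(2,2),(0,3),(1,3),(2,3)\}$; (A30) $\{(0,0),(1,0),(2,0),(1,1),(2,1),(0,3),(1,3),(2,3)\}$; (A31) $\{(1,0),(2,0),(3,0),(1,2),(2,2),(1,3),(2,3),(3,3)\}$; (A32) $\{(0,0),(0,1),(0,2),(2,1),(2,2),(3,0),(3,1),(3,2)\}$. Then the mesh patterns $(123,R)$ and $(321,R)$ are jointly equidistributed.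
   Context: $S_n$ is the set of permutations of $\{1,\dots,n\}$. A mesh pattern of length $k$ is a pair $(\tau,R)$ with $\tau\in S_k$ and $R\subseteq\{0,\dots,k\}^2$; the element $(a,b)\in R$ is the "shaded box" whose corners are $(a,b),(a,b+1),(a+1,b+1),(a+1,b)$ in the plot of $\tau$ (first coordinate = position, second = value). An occurrence of $(\tau,R)$ in $\pi=\pi_1\cdots\pi_n\in S_n$ is a tuple of indices $i_1<\dots<i_k$ such that $\pi_{i_1}\cdots\pi_{i_k}$ is order-isomorphic to $\tau$ and, setting $i_0=0$, $i_{k+1}=n+1$, letting $v_1<\dots<v_k$ be the values $\pi_{i_1},\dots,\pi_{i_k}$ in increasing order and $v_0=0$, $v_{k+1}=n+1$, for every $(a,b)\in R$ there is no index $m$ with $i_a<m<i_{a+1}$ and $v_b<\pi_m<v_{b+1}$. The number of occurrences is the number of such index tuples. Two mesh patterns $q_1,q_2$ are jointly equidistributed if for all $n\ge 1$ and all integers $k,\ell\ge 0$, the number of $\pi\in S_n$ with exactly $k$ occurrences of $q_1$ and exactly $\ell$ occurrences of $q_2$ equals the number with exactly $\ell$ occurrences of $q_1$ and exactly $k$ occurrences of $q_2$. -}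

module Defs where

open import Data.Nat using (ℕ; zero; suc; _+_; _<ᵇ_; _≡ᵇ_)
open import Data.Bool using (Bool; true; false; _∧_; _∨_; not; if_then_else_)
open import Data.List using (List; []; _∷_; _++_; length; filter; map; concatMap)
open import Data.Bool.ListAction using (all; any)
open import Data.Product using (_×_; _,_)
open import Relation.Nullary.Decidable using (Dec)
open import Data.Bool.Properties using (T?)
open import Data.Bool using (T)

-- Permutations are lists of natural numbers π₁ ⋯ πₙ (1-indexed positions,
-- values in {1,…,n}).

-- 1-indexed lookup with default 0 (index 0 / out of range gives 0)
at : List ℕ → ℕ → ℕ
at []       _             = 0
at (x ∷ xs) zero          = 0
at (x ∷ xs) (suc zero)    = x
at (x ∷ xs) (suc (suc i)) = at xs (suc i)

range : ℕ → ℕ → List ℕ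
range a zero    = []
range a (suc m) = a ∷ range (suc a) m

oneTo : ℕ → List ℕ
oneTo n = range 1 n

words : ℕ → ℕ → List (List ℕ)
words n zero    = [] ∷ []
words n (suc m) = concatMap (λ x → map (x ∷_) (words n m)) (oneTo n)

elemᵇ : ℕ → List ℕ → Bool
elemᵇ x ys = any (λ y → x ≡ᵇ y) ys

-- a word of length n over {1..n} is a permutation iff each of 1..n occurs in it
isPerm : ℕ → List ℕ → Bool
isPerm n w = all (λ x → elemᵇ x w) (oneTo n)

S : ℕ → List (List ℕ)
S n = filter (λ w → T? (isPerm n w)) (words n n)

choose : ℕ → List ℕ → List (List ℕ)
choose zero    _        = [] ∷ []
choose (suc k) []       = []
choose (suc k) (x ∷ xs) = map (x ∷_) (choose k xs) ++ choose (suc k) xs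

insert : ℕ → List ℕ → List ℕ
insert x []       = x ∷ []
insert x (y ∷ ys) = if x <ᵇ y then x ∷ y ∷ ys else y ∷ insert x ys

sort : List ℕ → List ℕ
sort []       = []
sort (x ∷ xs) = insert x (sort xs)

orderIso : List ℕ → List ℕ → Bool
orderIso xs τ =
  (length xs ≡ᵇ length τ) ∧
  all (λ a → all (λ b → eqB (at xs a <ᵇ at xs b) (at τ a <ᵇ at τ b))
                 (oneTo (length τ)))
      (oneTo (length τ))
  where
  eqB : Bool → Bool → Bool
  eqB true  true  = true
  eqB false false = true
  eqB _     _     = false

-- A mesh pattern (τ , R): τ a permutation of {1..k} (as a list), R a list of
-- shaded boxes (a , b) with 0 ≤ a , b ≤ k.
MeshPattern : Set
MeshPattern = List ℕ × List (ℕ × ℕ)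

-- With i₀ = 0, i_{k+1} = n+1, v₀ = 0, v_{k+1} = n+1 and v₁ < ⋯ < v_k the
-- sorted occurrence values; box (a , b) is empty iff no m with
-- i_a < m < i_{a+1} and v_b < π_m < v_{b+1}.
isOccurrence : MeshPattern → List ℕ → List ℕ → Bool
isOccurrence (τ , R) π is =
  orderIso vals τ ∧ all boxEmpty R
  where
  n    = length π
  vals = map (at π) is
  I    = (0 ∷ is) ++ (suc n ∷ [])
  V    = (0 ∷ sort vals) ++ (suc n ∷ [])
  -- 0-indexed access into I and V
  I! : ℕ → ℕ
  I! a = at I (suc a)
  V! : ℕ → ℕ
  V! b = at V (suc b)
  boxEmpty : ℕ × ℕ → Bool
  boxEmpty (a , b) =
    not (any (λ m → (I! a <ᵇ m) ∧ (m <ᵇ I! (suc a)) ∧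
                    (V! b <ᵇ at π m) ∧ (at π m <ᵇ V! (suc b)))
             (oneTo n))

occ : MeshPattern → List ℕ → ℕ
occ q π =
  length (filter (λ is → T? (isOccurrence q π is))
                 (choose (length (Data.Product.proj₁ q)) (oneTo (length π))))

jointCount : MeshPattern → MeshPattern → ℕ → ℕ → ℕ → ℕ
jointCount q₁ q₂ n k ℓ =
  length (filter (λ π → T? ((occ q₁ π ≡ᵇ k) ∧ (occ q₂ π ≡ᵇ ℓ))) (S n))

JointlyEquidistributed : MeshPattern → MeshPattern → Set
JointlyEquidistributed q₁ q₂ =
  (n : ℕ) → 1 Data.Nat.≤ n → (k ℓ : ℕ) →
  jointCount q₁ q₂ n k ℓ Relation.Binary.PropositionalEquality.≡ jointCount q₁ q₂ n ℓ k
  where import Relation.Binary.PropositionalEquality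

p123 : List ℕ
p123 = 1 ∷ 2 ∷ 3 ∷ []

p321 : List ℕ
p321 = 3 ∷ 2 ∷ 1 ∷ []

A25 A26 A27 A28 A29 A30 A31 A32 : List (ℕ × ℕ)
A25 = (0 , 0) ∷ (0 , 1) ∷ (0 , 2) ∷ (1 , 1) ∷ (1 , 2) ∷ (3 , 0) ∷ (3 , 1) ∷ (3 , 2) ∷ []
A26 = (1 , 0) ∷ (2 , 0) ∷ (3 , 0) ∷ (1 , 1) ∷ (2 , 1) ∷ (1 , 3) ∷ (2 , 3) ∷ (3 , 3) ∷ []
A27 = (0 , 1) ∷ (0 , 2) ∷ (0 , 3) ∷ (2 , 1) ∷ (2 , 2) ∷ (3 , 1) ∷ (3 , 2) ∷ (3 , 3) ∷ []
A28 = (0 , 1) ∷ (0 , 2) ∷ (0 , 3) ∷ (1 , 1) ∷ (1 , 2) ∷ (3 , 1) ∷ (3 , 2) ∷ (3 , 3) ∷ []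
A29 = (0 , 0) ∷ (1 , 0) ∷ (2 , 0) ∷ (1 , 2) ∷ (2 , 2) ∷ (0 , 3) ∷ (1 , 3) ∷ (2 , 3) ∷ []
A30 = (0 , 0) ∷ (1 , 0) ∷ (2 , 0) ∷ (1 , 1) ∷ (2 , 1) ∷ (0 , 3) ∷ (1 , 3) ∷ (2 , 3) ∷ []
A31 = (1 , 0) ∷ (2 , 0) ∷ (3 , 0) ∷ (1 , 2) ∷ (2 , 2) ∷ (1 , 3) ∷ (2 , 3) ∷ (3 , 3) ∷ []
A32 = (0 , 0) ∷ (0 , 1) ∷ (0 , 2) ∷ (2 , 1) ∷ (2 , 2) ∷ (3 , 0) ∷ (3 , 1) ∷ (3 , 2) ∷ []

theShadings : List (List (ℕ × ℕ))
theShadings = A25 ∷ A26 ∷ A27 ∷ A28 ∷ A29 ∷ A30 ∷ A31 ∷ A32 ∷ []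

-- Reversal turns an occurrence of (123, R) in the reverse of π into an occurrence of
-- (321, R′) in π, where R′ is R mirrored left to right; complementation does the same with R
-- mirrored top to bottom. For A25, A27, A28, A32 (reversal) and A26, A29, A30, A31
-- (complementation) the mirrored shading R′ is the partner of R in one of the pairs A25/A32,
-- A27/A28, A26/A31, A29/A30. Within a pair, the boxes not shared by both shadings say that the
-- middle letter of a 321-occurrence is the leftmost, rightmost, lowest or highest point inside
-- the rectangle spanned by the outer letters, while the shared boxes together only constrain
-- the outer letters. So an occurrence is determined by its outer letters, both shadings admit
-- the same pairs of outer letters, and (321, R) and (321, R′) occur equally often in every
-- permutation. Hence occ (123, R) (g π) = occ (321, R) π for an involution g of S n, and g
-- swaps the two counts.

module Submission where

open import Data.Bool using (Bool; true; false; T; _∧_; not)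
open import Data.Bool.ListAction using (all; any)
open import Data.Bool.Properties using (T?; T-∧; T-≡; T-not-≡; ∧-comm)
open import Data.Empty using (⊥; ⊥-elim)
open import Data.List using (List; []; _∷_; _++_; map; length; filter; reverse; concatMap; _∷ʳ_; upTo)
open import Data.List.Extrema.Nat using (argmin; argmax; argmin-all; argmax-all; f[argmin]≤f[xs]; f[xs]≤f[argmax])
open import Data.List.Membership.Propositional using (_∈_; lose; find)
open import Data.List.Membership.Propositional.Properties
  using (∈-map⁺; ∈-map⁻; ∈-filter⁺; ∈-filter⁻; ∈-++⁺ˡ; ∈-++⁺ʳ; ∈-++⁻; ∈-∃++; ∈-upTo⁺;
         ∈-concatMap⁺; ∈-concatMap⁻)
open import Data.List.Membership.Propositional.Properties.WithK using (unique∧set⇒bag)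
open import Data.List.Properties
  using (∷-injectiveʳ; map-∘; map-id-local; length-map; length-reverse; reverse-involutive;
         unfold-reverse; length-++)
open import Data.List.Relation.Binary.BagAndSetEquality using (∼bag⇒↭)
open import Data.List.Relation.Binary.Permutation.Propositional.Properties using (↭-length)
open import Data.List.Relation.Binary.Subset.Propositional using (_⊆_)
open import Data.List.Relation.Unary.All as All using (All; []; _∷_)
open import Data.List.Relation.Unary.All.Properties as AllP using (all⁺; all⁻)
open import Data.List.Relation.Unary.AllPairs using ([]; _∷_)
open import Data.List.Relation.Unary.Any as Any using (here; there)
open import Data.List.Relation.Unary.Any.Properties as AnyP using (any⁺; any⁻)
open import Data.List.Relation.Unary.Unique.Propositional using (Unique)
import Data.List.Relation.Unary.Unique.Propositional.Properties as Unique
open import Data.Nat using (ℕ; zero; suc; _+_; _∸_; _≤_; _<_; _<ᵇ_; _≡ᵇ_; z≤n; s≤s; z<s; _<?_)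
open import Data.Nat.Properties
open import Data.Product using (_×_; _,_; ∃-syntax; proj₁; proj₂)
open import Data.Product.Properties using (≡-dec)
open import Data.Sum using (_⊎_; inj₁; inj₂)
open import Data.Unit using (⊤; tt)
open import Function using (_∘_; id; _⇔_; mk⇔; Equivalence)
open import Function.Construct.Composition using (_⇔-∘_)
open import Function.Construct.Symmetry using (⇔-sym)
open import Relation.Binary.Definitions using (tri<; tri≈; tri>)
open import Relation.Binary.PropositionalEquality
open import Relation.Nullary using (¬_; yes; no; Dec)
open import Relation.Nullary.Decidable using (_×-dec_; True; toWitness)

open import Data.List.Relation.Binary.Subset.DecPropositional (≡-dec _≟_ _≟_) using (_⊆?_)
open import Defs

T-not⁻ : ∀ {b} → T (not b) → ¬ T b
T-not⁻ {true}  ()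
T-not⁻ {false} _ ()

T-not⁺ : ∀ {b} → ¬ T b → T (not b)
T-not⁺ {true}  ¬b = ¬b tt
T-not⁺ {false} _  = tt

T-injective : ∀ {a b} → T a ⇔ T b → a ≡ b
T-injective {true}  {true}  _   = refl
T-injective {true}  {false} a⇔b = ⊥-elim (Equivalence.to a⇔b tt)
T-injective {false} {true}  a⇔b = ⊥-elim (Equivalence.from a⇔b tt)
T-injective {false} {false} _   = refl

<ᵇ-true : ∀ {m n} → m < n → (m <ᵇ n) ≡ true
<ᵇ-true m<n = Equivalence.to T-≡ (<⇒<ᵇ m<n)

<ᵇ-false : ∀ {m n} → n ≤ m → (m <ᵇ n) ≡ false
<ᵇ-false {m} {n} n≤m = Equivalence.to T-not-≡ (T-not⁺ (λ m<ᵇn → <⇒≱ (<ᵇ⇒< m n m<ᵇn) n≤m))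

<ᵇ-irrefl : ∀ x → (x <ᵇ x) ≡ false
<ᵇ-irrefl x = <ᵇ-false {x} ≤-refl

≮∧≯⇒≡ : ∀ {m n} → ¬ m < n → ¬ n < m → m ≡ n
≮∧≯⇒≡ m≮n n≮m = ≤-antisym (≮⇒≥ n≮m) (≮⇒≥ m≮n)

-- Counting

count : {A : Set} → (A → Bool) → List A → ℕ
count p xs = length (filter (T? ∘ p) xs)

count-cong : ∀ {A : Set} (p q : A → Bool) xs → (∀ {x} → x ∈ xs → p x ≡ q x) → count p xs ≡ count q xs
count-cong p q []       _  = refl
count-cong p q (x ∷ xs) eq with p x | q x | eq (here refl) | count-cong p q xs (eq ∘ there)
... | true  | true  | refl | ih = cong suc ih
... | false | false | refl | ih = ih

map⁺-injectiveOn : ∀ {A B : Set} (f : A → B) {xs} → Unique xs →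
  (∀ {x y} → x ∈ xs → y ∈ xs → f x ≡ f y → x ≡ y) → Unique (map f xs)
map⁺-injectiveOn f {[]}     []         _   = []
map⁺-injectiveOn f {x ∷ xs} (x∉ ∷ uxs) inj =
  All.tabulate fx∉ ∷ map⁺-injectiveOn f uxs (λ y∈ z∈ → inj (there y∈) (there z∈))
  where
  fx∉ : ∀ {z} → z ∈ map f xs → f x ≢ z
  fx∉ z∈ fx≡z with ∈-map⁻ f z∈
  ... | y , y∈ , refl = All.lookup x∉ y∈ (inj (here refl) (there y∈) fx≡z)

length-≡-unique : ∀ {A : Set} {xs ys : List A} → Unique xs → Unique ys → xs ⊆ ys → ys ⊆ xs →
  length xs ≡ length ys
length-≡-unique uxs uys xs⊆ys ys⊆xs = ↭-length (∼bag⇒↭ (unique∧set⇒bag uxs uys (mk⇔ xs⊆ys ys⊆xs)))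

InjectiveOn : {A K : Set} → (A → Bool) → (A → K) → List A → Set
InjectiveOn p κ L = ∀ {s t} → s ∈ L → t ∈ L → T (p s) → T (p t) → κ s ≡ κ t → s ≡ t

KeysCovered : {A K : Set} → (A → Bool) → (A → K) → (A → Bool) → (A → K) → List A → Set
KeysCovered p κp q κq L = ∀ {s} → s ∈ L → T (p s) → ∃[ t ] t ∈ L × T (q t) × κq t ≡ κp s

count-≡-by-keys : ∀ {A K : Set} (p q : A → Bool) (κp κq : A → K) {L : List A} → Unique L →
  InjectiveOn p κp L → InjectiveOn q κq L → KeysCovered p κp q κq L → KeysCovered q κq p κp L →
  count p L ≡ count q L
count-≡-by-keys {A} {K} p q κp κq {L} uL injp injq covp covq = begin
  count p L          ≡⟨ length-map κp (filter (T? ∘ p) L) ⟨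
  length (keys p κp) ≡⟨ length-≡-unique (keys-unique p κp injp) (keys-unique q κq injq)
                          (keys-⊆ p κp q κq covp) (keys-⊆ q κq p κp covq) ⟩
  length (keys q κq) ≡⟨ length-map κq (filter (T? ∘ q) L) ⟩
  count q L          ∎
  where
  open ≡-Reasoning
  keys : (A → Bool) → (A → K) → List K
  keys r κ = map κ (filter (T? ∘ r) L)
  keys-unique : ∀ r κ → InjectiveOn r κ L → Unique (keys r κ)
  keys-unique r κ inj = map⁺-injectiveOn κ (Unique.filter⁺ (T? ∘ r) uL) λ s∈ t∈ →
    let (sL , rs) = ∈-filter⁻ (T? ∘ r) {xs = L} s∈ ; (tL , rt) = ∈-filter⁻ (T? ∘ r) {xs = L} t∈
    in inj sL tL rs rt
  keys-⊆ : ∀ r κr s κs → KeysCovered r κr s κs L → keys r κr ⊆ keys s κs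
  keys-⊆ r κr s κs cov z∈ with ∈-map⁻ κr z∈
  ... | t , t∈ , refl with ∈-filter⁻ (T? ∘ r) {xs = L} t∈
  ... | tL , rt with cov tL rt
  ... | t′ , t′L , st′ , κ≡ = subst (_∈ keys s κs) κ≡ (∈-map⁺ κs (∈-filter⁺ (T? ∘ s) t′L st′))

count-∘-involution : ∀ {A : Set} (g : A → A) {L : List A} → Unique L →
  (∀ {x} → x ∈ L → g x ∈ L) → (∀ {x} → x ∈ L → g (g x) ≡ x) →
  ∀ p → count p L ≡ count (p ∘ g) L
count-∘-involution g uL closed invol p = count-≡-by-keys p (p ∘ g) id g uL
  (λ _ _ _ _ s≡t → s≡t)
  (λ s∈ t∈ _ _ gs≡gt → trans (sym (invol s∈)) (trans (cong g gs≡gt) (invol t∈)))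
  (λ {s} s∈ ps → g s , closed s∈ , subst (T ∘ p) (sym (invol s∈)) ps , invol s∈)
  (λ {s} s∈ pgs → g s , closed s∈ , pgs , refl)

-- Indices, words and permutations

range-∈⁻ : ∀ a k {m} → m ∈ range a k → a ≤ m × m < a + k
range-∈⁻ a (suc k) (here refl) = ≤-refl , m<m+n a z<s
range-∈⁻ a (suc k) {m} (there m∈) with range-∈⁻ (suc a) k m∈
... | a<m , m<1+a+k = <⇒≤ a<m , subst (m <_) (sym (+-suc a k)) m<1+a+k

range-∈⁺ : ∀ a k {m} → a ≤ m → m < a + k → m ∈ range a k
range-∈⁺ a zero    a≤m m<a+0 = ⊥-elim (<⇒≱ m<a+0 (subst (_≤ _) (sym (+-identityʳ a)) a≤m))
range-∈⁺ a (suc k) {m} a≤m m<a+k with a ≟ m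
... | yes refl = here refl
... | no  a≢m  = there (range-∈⁺ (suc a) k (≤∧≢⇒< a≤m a≢m) (subst (m <_) (+-suc a k) m<a+k))

range-unique : ∀ a k → Unique (range a k)
range-unique a zero    = []
range-unique a (suc k) =
  All.tabulate (λ m∈ a≡m → <⇒≱ (proj₁ (range-∈⁻ (suc a) k m∈)) (≤-reflexive (sym a≡m)))
  ∷ range-unique (suc a) k

length-range : ∀ a k → length (range a k) ≡ k
length-range a zero    = refl
length-range a (suc k) = cong suc (length-range (suc a) k)

oneTo-∈⁻ : ∀ {n m} → m ∈ oneTo n → 1 ≤ m × m ≤ n
oneTo-∈⁻ {n} m∈ with range-∈⁻ 1 n m∈
... | 1≤m , m<1+n = 1≤m , ≤-pred m<1+n

oneTo-∈⁺ : ∀ {n m} → 1 ≤ m → m ≤ n → m ∈ oneTo n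
oneTo-∈⁺ {n} 1≤m m≤n = range-∈⁺ 1 n 1≤m (s≤s m≤n)

Increasing : ℕ → List ℕ → Set
Increasing lb []       = ⊤
Increasing lb (x ∷ xs) = lb ≤ x × Increasing (suc x) xs

Increasing-weaken : ∀ {lb lb′} xs → lb ≤ lb′ → Increasing lb′ xs → Increasing lb xs
Increasing-weaken []       _      _               = tt
Increasing-weaken (x ∷ xs) lb≤lb′ (lb′≤x , incr) = ≤-trans lb≤lb′ lb′≤x , incr

<-+suc : ∀ a m {x} → x < suc a + m → x < a + suc m
<-+suc a m {x} = subst (x <_) (sym (+-suc a m))

<-suc+ : ∀ a m {x} → x < a + suc m → x < suc a + m
<-suc+ a m {x} = subst (x <_) (+-suc a m)

choose-∈⁻ : ∀ k a m {t} → t ∈ choose k (range a m) → length t ≡ k × Increasing a t × All (_< a + m) t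
choose-∈⁻ zero    a m       (here refl) = refl , tt , []
choose-∈⁻ (suc k) a (suc m) {t} t∈ with ∈-++⁻ (map (a ∷_) (choose k (range (suc a) m))) t∈
... | inj₁ t∈head with ∈-map⁻ (a ∷_) t∈head
...   | t′ , t′∈ , refl with choose-∈⁻ k (suc a) m t′∈
...     | len , incr , bound = cong suc len , (≤-refl , incr) , m<m+n a z<s ∷ All.map (<-+suc a m) bound
choose-∈⁻ (suc k) a (suc m) {t} t∈ | inj₂ t∈tail with choose-∈⁻ (suc k) (suc a) m t∈tail
... | len , incr , bound = len , Increasing-weaken t (n≤1+n a) incr , All.map (<-+suc a m) bound

choose-∈⁺ : ∀ k a m t → length t ≡ k → Increasing a t → All (_< a + m) t → t ∈ choose k (range a m)
choose-∈⁺ zero    a m       []      _   _            _                 = here refl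
choose-∈⁺ (suc k) a zero    (x ∷ t) _   (a≤x , _)    (x<a+0 ∷ _)       =
  ⊥-elim (<⇒≱ x<a+0 (subst (_≤ x) (sym (+-identityʳ a)) a≤x))
choose-∈⁺ (suc k) a (suc m) (x ∷ t) len (a≤x , incr) (x<a+1+m ∷ bound) with a ≟ x
... | yes refl = ∈-++⁺ˡ (∈-map⁺ (a ∷_)
  (choose-∈⁺ k (suc a) m t (suc-injective len) incr (All.map (<-suc+ a m) bound)))
... | no  a≢x  = ∈-++⁺ʳ (map (a ∷_) (choose k (range (suc a) m)))
  (choose-∈⁺ (suc k) (suc a) m (x ∷ t) len (≤∧≢⇒< a≤x a≢x , incr) (All.map (<-suc+ a m) (x<a+1+m ∷ bound)))

choose-unique : ∀ k a m → Unique (choose k (range a m))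
choose-unique zero    a zero    = [] ∷ []
choose-unique zero    a (suc m) = [] ∷ []
choose-unique (suc k) a zero    = []
choose-unique (suc k) a (suc m) =
  Unique.++⁺ (Unique.map⁺ ∷-injectiveʳ (choose-unique k (suc a) m)) (choose-unique (suc k) (suc a) m) disjoint
  where
  disjoint : ∀ {t} → ¬ (t ∈ map (a ∷_) (choose k (range (suc a) m)) × t ∈ choose (suc k) (range (suc a) m))
  disjoint (t∈head , t∈tail) with ∈-map⁻ (a ∷_) t∈head
  ... | _ , _ , refl with choose-∈⁻ (suc k) (suc a) m t∈tail
  ... | _ , (1+a≤a , _) , _ = <-irrefl refl 1+a≤a

record Positions (n i j k : ℕ) : Set where
  constructor positions
  field
    1≤i : 1 ≤ i
    i<j : i < j
    j<k : j < k
    k≤n : k ≤ n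

  j≤n : j ≤ n
  j≤n = ≤-trans (<⇒≤ j<k) k≤n

  i≤n : i ≤ n
  i≤n = ≤-trans (<⇒≤ i<j) j≤n

  1≤j : 1 ≤ j
  1≤j = ≤-trans 1≤i (<⇒≤ i<j)

  1≤k : 1 ≤ k
  1≤k = ≤-trans 1≤j (<⇒≤ j<k)

Triples : ℕ → List (List ℕ)
Triples n = choose 3 (oneTo n)

data TripleView (n : ℕ) : List ℕ → Set where
  triple : ∀ {i j k} → Positions n i j k → TripleView n (i ∷ j ∷ k ∷ [])

triple-view : ∀ n {t} → t ∈ Triples n → TripleView n t
triple-view n t∈ with choose-∈⁻ 3 1 n t∈
triple-view n {i ∷ j ∷ k ∷ []} t∈ | _ , (1≤i , i<j , j<k , tt) , (_ ∷ _ ∷ k<1+n ∷ []) =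
  triple (positions 1≤i i<j j<k (≤-pred k<1+n))

triple-∈ : ∀ {n i j k} → Positions n i j k → (i ∷ j ∷ k ∷ []) ∈ Triples n
triple-∈ {n} {i} {j} {k} P =
  choose-∈⁺ 3 1 n (i ∷ j ∷ k ∷ []) refl (1≤i , i<j , j<k , tt) (s≤s i≤n ∷ s≤s j≤n ∷ s≤s k≤n ∷ [])
  where open Positions P

Triples-unique : ∀ n → Unique (Triples n)
Triples-unique n = choose-unique 3 1 n

words-∈⁻ : ∀ n m {w} → w ∈ words n m → length w ≡ m × All (_∈ oneTo n) w
words-∈⁻ n zero    (here refl) = refl , []
words-∈⁻ n (suc m) w∈ with find (∈-concatMap⁻ (λ x → map (x ∷_) (words n m)) {xs = oneTo n} w∈)
... | x , x∈ , w∈x∷ with ∈-map⁻ (x ∷_) w∈x∷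
... | w′ , w′∈ , refl with words-∈⁻ n m w′∈
... | len , values = cong suc len , x∈ ∷ values

words-∈⁺ : ∀ n m {w} → length w ≡ m → All (_∈ oneTo n) w → w ∈ words n m
words-∈⁺ n zero    {[]}    _   []             = here refl
words-∈⁺ n (suc m) {x ∷ w} len (x∈ ∷ values) = ∈-concatMap⁺ (λ y → map (y ∷_) (words n m))
  (lose x∈ (∈-map⁺ (x ∷_) (words-∈⁺ n m (suc-injective len) values)))

prefixed-unique : ∀ (W : List (List ℕ)) xs → Unique xs → Unique W → Unique (concatMap (λ x → map (x ∷_) W) xs)
prefixed-unique W []       _            _  = []
prefixed-unique W (x ∷ xs) (x∉ ∷ uxs) uW =
  Unique.++⁺ (Unique.map⁺ ∷-injectiveʳ uW) (prefixed-unique W xs uxs uW) disjoint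
  where
  disjoint : ∀ {v} → ¬ (v ∈ map (x ∷_) W × v ∈ concatMap (λ x → map (x ∷_) W) xs)
  disjoint (v∈head , v∈tail) with ∈-map⁻ (x ∷_) v∈head
  ... | _ , _ , refl with find (∈-concatMap⁻ (λ y → map (y ∷_) W) {xs = xs} v∈tail)
  ... | y , y∈ , xw∈ with ∈-map⁻ (y ∷_) xw∈
  ... | _ , _ , refl = All.lookup x∉ y∈ refl

words-unique : ∀ n m → Unique (words n m)
words-unique n zero    = [] ∷ []
words-unique n (suc m) = prefixed-unique (words n m) (oneTo n) (range-unique 1 n) (words-unique n m)

elemᵇ⁻ : ∀ {x ys} → T (elemᵇ x ys) → x ∈ ys
elemᵇ⁻ {x} {ys} t = Any.map (λ {y} → ≡ᵇ⇒≡ x y) (any⁻ (x ≡ᵇ_) ys t)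

elemᵇ⁺ : ∀ {x ys} → x ∈ ys → T (elemᵇ x ys)
elemᵇ⁺ {x} x∈ = any⁺ (x ≡ᵇ_) (Any.map (λ {y} → ≡⇒≡ᵇ x y) x∈)

at-∈ : ∀ xs {m} → 1 ≤ m → m ≤ length xs → at xs m ∈ xs
at-∈ (x ∷ xs) {suc zero}    _ _         = here refl
at-∈ (x ∷ xs) {suc (suc m)} _ (s≤s m<) = there (at-∈ xs (s≤s z≤n) m<)

at-map : ∀ (h : ℕ → ℕ) xs {m} → 1 ≤ m → m ≤ length xs → at (map h xs) m ≡ h (at xs m)
at-map h (x ∷ xs) {suc zero}    _ _        = refl
at-map h (x ∷ xs) {suc (suc m)} _ (s≤s m<) = at-map h xs (s≤s z≤n) m<

at-∷ʳ : ∀ xs (y : ℕ) {m} → m ≤ length xs → at (xs ∷ʳ y) m ≡ at xs m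
at-∷ʳ []       y {zero}        _        = refl
at-∷ʳ (x ∷ xs) y {zero}        _        = refl
at-∷ʳ (x ∷ xs) y {suc zero}    _        = refl
at-∷ʳ (x ∷ xs) y {suc (suc m)} (s≤s m<) = at-∷ʳ xs y m<

at-∷ʳ-last : ∀ xs (y : ℕ) → at (xs ∷ʳ y) (suc (length xs)) ≡ y
at-∷ʳ-last []       y = refl
at-∷ʳ-last (x ∷ xs) y = at-∷ʳ-last xs y

at-reverse : ∀ xs {m m′} → m + m′ ≡ suc (length xs) → 1 ≤ m → 1 ≤ m′ → at (reverse xs) m ≡ at xs m′
at-reverse []       {suc m} {suc m′} eq _ _ = ⊥-elim (m+1+n≢0 m (suc-injective eq))
at-reverse (x ∷ xs) {m} {suc zero} eq _ _ rewrite unfold-reverse x xs = begin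
  at (reverse xs ∷ʳ x) m                          ≡⟨ cong (at (reverse xs ∷ʳ x)) m≡ ⟩
  at (reverse xs ∷ʳ x) (suc (length (reverse xs))) ≡⟨ at-∷ʳ-last (reverse xs) x ⟩
  x                                               ∎
  where
  open ≡-Reasoning
  m≡ : m ≡ suc (length (reverse xs))
  m≡ = trans (suc-injective (trans (+-comm 1 m) eq)) (cong suc (sym (length-reverse xs)))
at-reverse (x ∷ xs) {m} {suc (suc m′)} eq 1≤m _ rewrite unfold-reverse x xs = begin
  at (reverse xs ∷ʳ x) m ≡⟨ at-∷ʳ (reverse xs) x (subst (m ≤_) (sym (length-reverse xs)) m≤) ⟩
  at (reverse xs) m      ≡⟨ at-reverse xs eq′ 1≤m (s≤s z≤n) ⟩
  at xs (suc m′)         ∎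
  where
  open ≡-Reasoning
  eq′ : m + suc m′ ≡ suc (length xs)
  eq′ = suc-injective (trans (sym (+-suc m (suc m′))) eq)
  m≤ : m ≤ length xs
  m≤ = subst (m ≤_) (suc-injective (trans (sym (+-suc m m′)) eq′)) (m≤m+n m m′)

length-≤-unique-⊆ : ∀ {A : Set} {xs ys : List A} → Unique xs → xs ⊆ ys → length xs ≤ length ys
length-≤-unique-⊆ {xs = []}     _            _     = z≤n
length-≤-unique-⊆ {xs = x ∷ xs} (x∉ ∷ uxs) xs⊆ys with ∈-∃++ (xs⊆ys (here refl))
... | us , vs , refl = ≤-trans (s≤s (length-≤-unique-⊆ uxs xs⊆us++vs)) (≤-reflexive (sym length-split))
  where
  xs⊆us++vs : xs ⊆ us ++ vs
  xs⊆us++vs {z} z∈ with ∈-++⁻ us (xs⊆ys (there z∈))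
  ... | inj₁ z∈us          = ∈-++⁺ˡ z∈us
  ... | inj₂ (here refl)   = ⊥-elim (All.lookup x∉ z∈ refl)
  ... | inj₂ (there z∈vs) = ∈-++⁺ʳ us z∈vs
  length-split : length (us ++ x ∷ vs) ≡ suc (length (us ++ vs))
  length-split = trans (length-++ us) (trans (+-suc (length us) (length vs)) (cong suc (sym (length-++ us))))

repeat⇒shorter-cover : ∀ xs {p q} → 1 ≤ p → p < q → q ≤ length xs → at xs p ≡ at xs q →
  ∃[ ys ] length ys < length xs × xs ⊆ ys
repeat⇒shorter-cover (x ∷ xs) {suc zero} {suc (suc q)} _ _ (s≤s q<) x≡ = xs , ≤-refl , cover
  where
  cover : x ∷ xs ⊆ xs
  cover (here refl) = subst (_∈ xs) (sym x≡) (at-∈ xs (s≤s z≤n) q<)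
  cover (there z∈)  = z∈
repeat⇒shorter-cover (x ∷ xs) {suc zero} {suc zero} _ (s≤s ()) _ _
repeat⇒shorter-cover (x ∷ xs) {suc (suc p)} {suc (suc q)} _ (s≤s p<q) (s≤s q<) eq
  with repeat⇒shorter-cover xs (s≤s z≤n) p<q q< eq
... | ys , shorter , cover = x ∷ ys , s≤s shorter , cover′
  where
  cover′ : x ∷ xs ⊆ x ∷ ys
  cover′ (here refl) = here refl
  cover′ (there z∈)  = there (cover z∈)

record IsPermutation (n : ℕ) (π : List ℕ) : Set where
  field
    length≡n : length π ≡ n
    values   : All (_∈ oneTo n) π
    onto     : ∀ {x} → x ∈ oneTo n → x ∈ π

  at-∈-oneTo : ∀ {m} → 1 ≤ m → m ≤ n → at π m ∈ oneTo n
  at-∈-oneTo 1≤m m≤n = All.lookup values (at-∈ π 1≤m (subst (_ ≤_) (sym length≡n) m≤n))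

  private
    no-repeat : ∀ {p q} → 1 ≤ p → p < q → q ≤ n → at π p ≢ at π q
    no-repeat 1≤p p<q q≤n eq with repeat⇒shorter-cover π 1≤p p<q (subst (_ ≤_) (sym length≡n) q≤n) eq
    ... | ys , shorter , cover = <⇒≱ shorter (begin
      length π           ≡⟨ trans length≡n (sym (length-range 1 n)) ⟩
      length (oneTo n)   ≤⟨ length-≤-unique-⊆ (range-unique 1 n) (cover ∘ onto) ⟩
      length ys          ∎)
      where open ≤-Reasoning

  at-injective : ∀ {p q} → 1 ≤ p → p ≤ n → 1 ≤ q → q ≤ n → at π p ≡ at π q → p ≡ q
  at-injective 1≤p p≤n 1≤q q≤n eq with <-cmp _ _
  ... | tri< p<q _ _ = ⊥-elim (no-repeat 1≤p p<q q≤n eq)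
  ... | tri≈ _ p≡q _ = p≡q
  ... | tri> _ _ q<p = ⊥-elim (no-repeat 1≤q q<p p≤n (sym eq))

S-∈⁻ : ∀ n {π} → π ∈ S n → IsPermutation n π
S-∈⁻ n {π} π∈ with ∈-filter⁻ (T? ∘ isPerm n) {xs = words n n} π∈
... | w∈ , perm with words-∈⁻ n n w∈
... | len , values = record
  { length≡n = len
  ; values   = values
  ; onto     = λ x∈ → elemᵇ⁻ (All.lookup (all⁺ _ (oneTo n) perm) x∈) }

S-∈⁺ : ∀ n {π} → IsPermutation n π → π ∈ S n
S-∈⁺ n {π} P = ∈-filter⁺ (T? ∘ isPerm n) (words-∈⁺ n n length≡n values)
  (all⁻ _ (All.tabulate (elemᵇ⁺ ∘ onto)))
  where open IsPermutation P

S-unique : ∀ n → Unique (S n)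
S-unique n = Unique.filter⁺ (T? ∘ isPerm n) (words-unique n n)

-- Occurrences of patterns of length three

orderIso-123⁺ : ∀ {x y z} → x < y → y < z → T (orderIso (x ∷ y ∷ z ∷ []) p123)
orderIso-123⁺ {x} {y} {z} x<y y<z
  rewrite <ᵇ-irrefl x | <ᵇ-irrefl y | <ᵇ-irrefl z
        | <ᵇ-true x<y | <ᵇ-true y<z | <ᵇ-true (<-trans x<y y<z)
        | <ᵇ-false (<⇒≤ x<y) | <ᵇ-false (<⇒≤ y<z) | <ᵇ-false (<⇒≤ (<-trans x<y y<z)) = tt

-- orderIso compares all nine ordered pairs; the case splits below supply just enough
-- comparisons for it to evaluate to false.
orderIso-123-¬< : ∀ {x y z} → ¬ x < y → ¬ T (orderIso (x ∷ y ∷ z ∷ []) p123)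
orderIso-123-¬< {x} {y} x≮y rewrite <ᵇ-irrefl x | <ᵇ-false (≮⇒≥ x≮y) = id

orderIso-123-<¬< : ∀ {x y z} → x < y → ¬ y < z → ¬ T (orderIso (x ∷ y ∷ z ∷ []) p123)
orderIso-123-<¬< {x} {y} {z} x<y y≮z
  rewrite <ᵇ-irrefl x | <ᵇ-irrefl y | <ᵇ-true x<y | <ᵇ-false (<⇒≤ x<y) | <ᵇ-false (≮⇒≥ y≮z) with x <ᵇ z
... | true  = id
... | false = id

orderIso-123⁻ : ∀ {x y z} → T (orderIso (x ∷ y ∷ z ∷ []) p123) → x < y × y < z
orderIso-123⁻ {x} {y} {z} iso with x <? y | y <? z
... | yes x<y | yes y<z = x<y , y<z
... | no  x≮y | _       = ⊥-elim (orderIso-123-¬< x≮y iso)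
... | yes x<y | no  y≮z = ⊥-elim (orderIso-123-<¬< x<y y≮z iso)

orderIso-321⁺ : ∀ {x y z} → z < y → y < x → T (orderIso (x ∷ y ∷ z ∷ []) p321)
orderIso-321⁺ {x} {y} {z} z<y y<x
  rewrite <ᵇ-irrefl x | <ᵇ-irrefl y | <ᵇ-irrefl z
        | <ᵇ-true z<y | <ᵇ-true y<x | <ᵇ-true (<-trans z<y y<x)
        | <ᵇ-false (<⇒≤ z<y) | <ᵇ-false (<⇒≤ y<x) | <ᵇ-false (<⇒≤ (<-trans z<y y<x)) = tt

orderIso-321-¬< : ∀ {x y z} → ¬ y < x → ¬ T (orderIso (x ∷ y ∷ z ∷ []) p321)
orderIso-321-¬< {x} {y} {z} y≮x rewrite <ᵇ-irrefl x | <ᵇ-false (≮⇒≥ y≮x) with x <ᵇ y | x <ᵇ z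
... | true  | _     = id
... | false | true  = id
... | false | false = id

orderIso-321-<¬< : ∀ {x y z} → y < x → ¬ z < y → ¬ T (orderIso (x ∷ y ∷ z ∷ []) p321)
orderIso-321-<¬< {x} {y} {z} y<x z≮y
  rewrite <ᵇ-irrefl x | <ᵇ-irrefl y | <ᵇ-true y<x | <ᵇ-false (<⇒≤ y<x) | <ᵇ-false (≮⇒≥ z≮y)
  with x <ᵇ z | y <ᵇ z | z <ᵇ x
... | true  | _     | _     = id
... | false | true  | _     = id
... | false | false | true  = id
... | false | false | false = id

orderIso-321⁻ : ∀ {x y z} → T (orderIso (x ∷ y ∷ z ∷ []) p321) → z < y × y < x
orderIso-321⁻ {x} {y} {z} iso with y <? x | z <? y
... | yes y<x | yes z<y = z<y , y<x
... | no  y≮x | _       = ⊥-elim (orderIso-321-¬< y≮x iso)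
... | yes y<x | no  z≮y = ⊥-elim (orderIso-321-<¬< y<x z≮y iso)

sort-123 : ∀ {x y z} → x < y → y < z → sort (x ∷ y ∷ z ∷ []) ≡ x ∷ y ∷ z ∷ []
sort-123 x<y y<z rewrite <ᵇ-true y<z | <ᵇ-true x<y = refl

sort-321 : ∀ {x y z} → z < y → y < x → sort (x ∷ y ∷ z ∷ []) ≡ z ∷ y ∷ x ∷ []
sort-321 z<y y<x rewrite <ᵇ-false (<⇒≤ z<y) | <ᵇ-false (<⇒≤ (<-trans z<y y<x)) | <ᵇ-false (<⇒≤ y<x) = refl

EmptyBox : (ℕ → ℕ) → ℕ → ℕ → ℕ → ℕ → Set
EmptyBox f lo hi u v = ∀ m → lo < m → m < hi → u < f m → f m < v → ⊥

grid : ℕ → ℕ → ℕ → ℕ → List ℕ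
grid n x y z = 0 ∷ x ∷ y ∷ z ∷ suc n ∷ []

-- Grid lines are numbered from 0, as in isOccurrence, while at is 1-indexed.
BoxAt : (ℕ → ℕ) → List ℕ → List ℕ → ℕ × ℕ → Set
BoxAt f I V (a , b) = EmptyBox f (at I (suc a)) (at I (suc (suc a))) (at V (suc b)) (at V (suc (suc b)))

Shaded : List (ℕ × ℕ) → (ℕ → ℕ) → ℕ → (i j k a b c : ℕ) → Set
Shaded R f n i j k a b c = All (BoxAt f (grid n i j k) (grid n a b c)) R

Occ123 : List (ℕ × ℕ) → (ℕ → ℕ) → ℕ → ℕ → ℕ → ℕ → Set
Occ123 R f n i j k = (f i < f j × f j < f k) × Shaded R f n i j k (f i) (f j) (f k)

Occ321 : List (ℕ × ℕ) → (ℕ → ℕ) → ℕ → ℕ → ℕ → ℕ → Set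
Occ321 R f n i j k = (f k < f j × f j < f i) × Shaded R f n i j k (f k) (f j) (f i)

Shaded-values : ∀ {R f n i j k a b c a′ b′ c′} → a ≡ a′ → b ≡ b′ → c ≡ c′ →
  Shaded R f n i j k a b c → Shaded R f n i j k a′ b′ c′
Shaded-values refl refl refl shaded = shaded

Shaded-⊆ : ∀ {R R′ f n i j k a b c} → R ⊆ R′ → Shaded R′ f n i j k a b c → Shaded R f n i j k a b c
Shaded-⊆ R⊆R′ shaded = All.tabulate (All.lookup shaded ∘ R⊆R′)

-- The box test local to isOccurrence, restated so that it can be named.
emptyBoxᵇ : List ℕ → List ℕ → List ℕ → ℕ × ℕ → Bool
emptyBoxᵇ π I V (a , b) = not (any (λ m → (at I (suc a) <ᵇ m) ∧ (m <ᵇ at I (suc (suc a))) ∧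
                                          (at V (suc b) <ᵇ at π m) ∧ (at π m <ᵇ at V (suc (suc b))))
                                   (oneTo (length π)))

emptyBoxᵇ⁻ : ∀ π I V ab → at I (suc (suc (proj₁ ab))) ≤ suc (length π) →
  T (emptyBoxᵇ π I V ab) → BoxAt (at π) I V ab
emptyBoxᵇ⁻ π I V (a , b) hi≤ empty m lo<m m<hi u<πm πm<v =
  T-not⁻ empty (any⁺ _ (lose (oneTo-∈⁺ (≤-trans (s≤s z≤n) lo<m) (≤-pred (≤-trans m<hi hi≤)))
    (Equivalence.from T-∧ (<⇒<ᵇ lo<m , Equivalence.from T-∧ (<⇒<ᵇ m<hi ,
     Equivalence.from T-∧ (<⇒<ᵇ u<πm , <⇒<ᵇ πm<v))))))

emptyBoxᵇ⁺ : ∀ π I V ab → BoxAt (at π) I V ab → T (emptyBoxᵇ π I V ab)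
emptyBoxᵇ⁺ π I V (a , b) empty = T-not⁺ λ hit → let m , _ , inside = find (any⁻ _ (oneTo (length π)) hit) in
  let (lo<m , rest₁) = Equivalence.to T-∧ inside ; (m<hi , rest₂) = Equivalence.to T-∧ rest₁
      (u<πm , πm<v) = Equivalence.to T-∧ rest₂ in
  empty m (<ᵇ⇒< _ _ lo<m) (<ᵇ⇒< _ _ m<hi) (<ᵇ⇒< _ _ u<πm) (<ᵇ⇒< _ _ πm<v)

grid-bounded : ∀ {n i j k} → Positions n i j k → ∀ a → at (grid n i j k) (suc (suc a)) ≤ suc n
grid-bounded P zero                      = m≤n⇒m≤1+n (Positions.i≤n P)
grid-bounded P (suc zero)                = m≤n⇒m≤1+n (Positions.j≤n P)
grid-bounded P (suc (suc zero))          = m≤n⇒m≤1+n (Positions.k≤n P)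
grid-bounded P (suc (suc (suc zero)))    = ≤-refl
grid-bounded P (suc (suc (suc (suc a)))) = z≤n

all-emptyBoxᵇ⇔ : ∀ R π {i j k a b c} → Positions (length π) i j k →
  T (all (emptyBoxᵇ π (grid (length π) i j k) (grid (length π) a b c)) R) ⇔ Shaded R (at π) (length π) i j k a b c
all-emptyBoxᵇ⇔ R π {i} {j} {k} {a} {b} {c} P = mk⇔
  (λ empty → All.map (λ {ab} → emptyBoxᵇ⁻ π I V ab (grid-bounded P (proj₁ ab))) (all⁺ _ R empty))
  (λ shaded → all⁻ _ (All.map (λ {ab} → emptyBoxᵇ⁺ π I V ab) shaded))
  where
  I = grid (length π) i j k
  V = grid (length π) a b c

sortedBoxesᵇ : List (ℕ × ℕ) → List ℕ → ℕ → ℕ → ℕ → List ℕ → Bool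
sortedBoxesᵇ R π i j k vs = all (emptyBoxᵇ π (grid (length π) i j k) ((0 ∷ vs) ++ (suc (length π) ∷ []))) R

occurrence123⇔ : ∀ R π {n i j k} → length π ≡ n → Positions n i j k →
  T (isOccurrence (p123 , R) π (i ∷ j ∷ k ∷ [])) ⇔ Occ123 R (at π) n i j k
occurrence123⇔ R π {i = i} {j} {k} refl P = mk⇔ to from
  where
  boxes : List ℕ → Bool
  boxes = sortedBoxesᵇ R π i j k
  to : T (isOccurrence (p123 , R) π (i ∷ j ∷ k ∷ [])) → Occ123 R (at π) (length π) i j k
  to occ with Equivalence.to T-∧ occ
  ... | iso , empty with orderIso-123⁻ iso
  ... | x<y , y<z =
    (x<y , y<z) , Equivalence.to (all-emptyBoxᵇ⇔ R π P) (subst (T ∘ boxes) (sort-123 x<y y<z) empty)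
  from : Occ123 R (at π) (length π) i j k → T (isOccurrence (p123 , R) π (i ∷ j ∷ k ∷ []))
  from ((x<y , y<z) , shaded) = Equivalence.from T-∧
    (orderIso-123⁺ x<y y<z ,
     subst (T ∘ boxes) (sym (sort-123 x<y y<z)) (Equivalence.from (all-emptyBoxᵇ⇔ R π P) shaded))

occurrence321⇔ : ∀ R π {n i j k} → length π ≡ n → Positions n i j k →
  T (isOccurrence (p321 , R) π (i ∷ j ∷ k ∷ [])) ⇔ Occ321 R (at π) n i j k
occurrence321⇔ R π {i = i} {j} {k} refl P = mk⇔ to from
  where
  boxes : List ℕ → Bool
  boxes = sortedBoxesᵇ R π i j k
  to : T (isOccurrence (p321 , R) π (i ∷ j ∷ k ∷ [])) → Occ321 R (at π) (length π) i j k
  to occ with Equivalence.to T-∧ occ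
  ... | iso , empty with orderIso-321⁻ iso
  ... | z<y , y<x =
    (z<y , y<x) , Equivalence.to (all-emptyBoxᵇ⇔ R π P) (subst (T ∘ boxes) (sort-321 z<y y<x) empty)
  from : Occ321 R (at π) (length π) i j k → T (isOccurrence (p321 , R) π (i ∷ j ∷ k ∷ []))
  from ((z<y , y<x) , shaded) = Equivalence.from T-∧
    (orderIso-321⁺ z<y y<x ,
     subst (T ∘ boxes) (sym (sort-321 z<y y<x)) (Equivalence.from (all-emptyBoxᵇ⇔ R π P) shaded))

occ≡count : ∀ τ R π {n} → length π ≡ n →
  occ (τ , R) π ≡ count (isOccurrence (τ , R) π) (choose (length τ) (oneTo n))
occ≡count τ R π refl = refl

-- Reverse and complement

complement : List ℕ → List ℕ
complement π = map (suc (length π) ∸_) π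

length-complement : ∀ π → length (complement π) ≡ length π
length-complement π = length-map (suc (length π) ∸_) π

oneTo-complement : ∀ {n x} → x ∈ oneTo n → suc n ∸ x ∈ oneTo n
oneTo-complement x∈ with oneTo-∈⁻ x∈
... | 1≤x , x≤n = oneTo-∈⁺ (m<n⇒0<n∸m (s≤s x≤n)) (∸-monoʳ-≤ _ 1≤x)

module _ {n : ℕ} {π : List ℕ} (P : IsPermutation n π) where
  open IsPermutation P

  reverse-IsPermutation : IsPermutation n (reverse π)
  reverse-IsPermutation = record
    { length≡n = trans (length-reverse π) length≡n
    ; values   = All.tabulate (All.lookup values ∘ AnyP.reverse⁻)
    ; onto     = AnyP.reverse⁺ ∘ onto }

  complement-involutive : complement (complement π) ≡ π
  complement-involutive rewrite length-complement π | length≡n =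
    trans (sym (map-∘ π))
      (map-id-local (All.map (λ x∈ → m∸[m∸n]≡n (m≤n⇒m≤1+n (proj₂ (oneTo-∈⁻ x∈)))) values))

  complement-IsPermutation : IsPermutation n (complement π)
  complement-IsPermutation = record
    { length≡n = trans (length-complement π) length≡n
    ; values   = All.tabulate values′
    ; onto     = onto′ }
    where
    values′ : ∀ {x} → x ∈ complement π → x ∈ oneTo n
    values′ x∈ with ∈-map⁻ (suc (length π) ∸_) x∈
    ... | y , y∈ , refl rewrite length≡n = oneTo-complement (All.lookup values y∈)
    onto′ : ∀ {x} → x ∈ oneTo n → x ∈ complement π
    onto′ {x} x∈ rewrite length≡n =
      subst (_∈ map (suc n ∸_) π) (m∸[m∸n]≡n (m≤n⇒m≤1+n (proj₂ (oneTo-∈⁻ x∈))))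
        (∈-map⁺ (suc n ∸_) (onto (oneTo-complement x∈)))

-- Indices beyond the grid name empty boxes; they are left fixed.
mirror : ℕ → ℕ
mirror 0 = 3
mirror 1 = 2
mirror 2 = 1
mirror 3 = 0
mirror a = a

reflectColumns : ℕ × ℕ → ℕ × ℕ
reflectColumns (a , b) = mirror a , b

reflectRows : ℕ × ℕ → ℕ × ℕ
reflectRows (a , b) = a , mirror b

mirror-between : ∀ {N lo hi lo′ hi′ m} → lo′ + hi ≡ N → hi′ + lo ≡ N → lo′ < m → m < hi′ →
  ∃[ m′ ] m + m′ ≡ N × lo < m′ × m′ < hi
mirror-between {N} {lo} {hi} {lo′} {hi′} {m} lo′+hi hi′+lo lo′<m m<hi′ = N ∸ m , m+m′ , lo<m′ , m′<hi
  where
  m+m′ : m + (N ∸ m) ≡ N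
  m+m′ = m+[n∸m]≡n (≤-trans (<⇒≤ m<hi′) (subst (hi′ ≤_) hi′+lo (m≤m+n hi′ lo)))
  lo<m′ : lo < N ∸ m
  lo<m′ = +-cancelʳ-< m lo (N ∸ m) (subst (lo + m <_)
    (trans (trans (+-comm lo hi′) hi′+lo) (trans (sym m+m′) (+-comm m (N ∸ m)))) (+-monoʳ-< lo m<hi′))
  m′<hi : N ∸ m < hi
  m′<hi = +-cancelʳ-< lo′ (N ∸ m) hi (subst ((N ∸ m) + lo′ <_)
    (trans (+-comm (N ∸ m) m) (trans m+m′ (trans (sym lo′+hi) (+-comm lo′ hi)))) (+-monoʳ-< (N ∸ m) lo′<m))

+≡+⇒<⇒> : ∀ {a b c d} → a + b ≡ c + d → a < c → d < b
+≡+⇒<⇒> {a} {b} {c} {d} a+b≡c+d a<c = +-cancelˡ-< c d b (subst (_< c + b) a+b≡c+d (+-monoˡ-< b a<c))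

Mirrored : (ℕ → ℕ) → (ℕ → ℕ) → ℕ → Set
Mirrored f g N = ∀ {m m′} → m + m′ ≡ N → 1 ≤ m → 1 ≤ m′ → g m′ ≡ f m

Mirrored-sym : ∀ {f g N} → Mirrored f g N → Mirrored g f N
Mirrored-sym g≡f {m} {m′} m+m′ 1≤m 1≤m′ = sym (g≡f (trans (+-comm m′ m) m+m′) 1≤m′ 1≤m)

EmptyBox-mirror : ∀ {f g N lo hi lo′ hi′ u v} → Mirrored f g N → lo′ + hi ≡ N → hi′ + lo ≡ N →
  EmptyBox g lo hi u v → EmptyBox f lo′ hi′ u v
EmptyBox-mirror {f} {g} {u = u} {v = v} g≡f lo′+hi hi′+lo empty m lo′<m m<hi′ u<fm fm<v
  with mirror-between lo′+hi hi′+lo lo′<m m<hi′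
... | m′ , m+m′ , lo<m′ , m′<hi =
  empty m′ lo<m′ m′<hi (subst (u <_) (sym gm′≡fm) u<fm) (subst (_< v) (sym gm′≡fm) fm<v)
  where
  gm′≡fm : g m′ ≡ f m
  gm′≡fm = g≡f m+m′ (≤-trans (s≤s z≤n) lo′<m) (≤-trans (s≤s z≤n) lo<m′)

Complementary : (ℕ → ℕ) → (ℕ → ℕ) → ℕ → Set
Complementary f g n = ∀ {m} → 1 ≤ m → m ≤ n → g m + f m ≡ suc n

Complementary-sym : ∀ {f g n} → Complementary f g n → Complementary g f n
Complementary-sym {f} {g} g+f {m} 1≤m m≤n = trans (+-comm (f m) (g m)) (g+f 1≤m m≤n)

EmptyBox-complement : ∀ {f g n lo hi u v u′ v′} → Complementary f g n → hi ≤ suc n →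
  u′ + v ≡ suc n → v′ + u ≡ suc n → EmptyBox g lo hi u v → EmptyBox f lo hi u′ v′
EmptyBox-complement {f} {g} {n} {u = u} {v} {u′} {v′} g+f hi≤ u′+v v′+u empty m lo<m m<hi u′<fm fm<v′ =
  empty m lo<m m<hi (+≡+⇒<⇒> (trans fm+gm (sym v′+u)) fm<v′) (+≡+⇒<⇒> (trans u′+v (sym fm+gm)) u′<fm)
  where
  fm+gm : f m + g m ≡ suc n
  fm+gm = trans (+-comm (f m) (g m)) (g+f (≤-trans (s≤s z≤n) lo<m) (≤-pred (≤-trans m<hi hi≤)))

module Reverse {f g : ℕ → ℕ} {n : ℕ} (g≡f : Mirrored f g (suc n))
  {i j k i′ j′ k′ : ℕ} (P : Positions n i j k) (P′ : Positions n i′ j′ k′)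
  (i′+k : i′ + k ≡ suc n) (j′+j : j′ + j ≡ suc n) (k′+i : k′ + i ≡ suc n) where

  private
    k+i′ : k + i′ ≡ suc n
    k+i′ = trans (+-comm k i′) i′+k
    j+j′ : j + j′ ≡ suc n
    j+j′ = trans (+-comm j j′) j′+j
    i+k′ : i + k′ ≡ suc n
    i+k′ = trans (+-comm i k′) k′+i
    f≡g : Mirrored g f (suc n)
    f≡g = Mirrored-sym {f} {g} g≡f

  box⁺ : ∀ {V} ab → BoxAt g (grid n i′ j′ k′) V ab → BoxAt f (grid n i j k) V (reflectColumns ab)
  box⁺ (0 , b) = EmptyBox-mirror g≡f k+i′ (+-identityʳ (suc n))
  box⁺ (1 , b) = EmptyBox-mirror g≡f j+j′ k+i′
  box⁺ (2 , b) = EmptyBox-mirror g≡f i+k′ j+j′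
  box⁺ (3 , b) = EmptyBox-mirror g≡f refl i+k′
  box⁺ (suc (suc (suc (suc a))) , b) empty m _ ()

  box⁻ : ∀ {V} ab → BoxAt f (grid n i j k) V (reflectColumns ab) → BoxAt g (grid n i′ j′ k′) V ab
  box⁻ (0 , b) = EmptyBox-mirror f≡g refl i′+k
  box⁻ (1 , b) = EmptyBox-mirror f≡g i′+k j′+j
  box⁻ (2 , b) = EmptyBox-mirror f≡g j′+j k′+i
  box⁻ (3 , b) = EmptyBox-mirror f≡g k′+i (+-identityʳ (suc n))
  box⁻ (suc (suc (suc (suc a))) , b) empty m _ ()

  private
    gi′ : g i′ ≡ f k
    gi′ = g≡f k+i′ (Positions.1≤k P) (Positions.1≤i P′)
    gj′ : g j′ ≡ f j
    gj′ = g≡f j+j′ (Positions.1≤j P) (Positions.1≤j P′)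
    gk′ : g k′ ≡ f i
    gk′ = g≡f i+k′ (Positions.1≤i P) (Positions.1≤k P′)
    V : List ℕ
    V = grid n (f k) (f j) (f i)

  occurrence⇔ : ∀ R → Occ123 R g n i′ j′ k′ ⇔ Occ321 (map reflectColumns R) f n i j k
  occurrence⇔ R = mk⇔
    (λ ((gi<gj , gj<gk) , shaded) → (subst₂ _<_ gi′ gj′ gi<gj , subst₂ _<_ gj′ gk′ gj<gk) ,
      AllP.map⁺ (All.map (λ {ab} → box⁺ {V} ab) (Shaded-values gi′ gj′ gk′ shaded)))
    (λ ((fk<fj , fj<fi) , shaded) →
      (subst₂ _<_ (sym gi′) (sym gj′) fk<fj , subst₂ _<_ (sym gj′) (sym gk′) fj<fi) ,
      Shaded-values (sym gi′) (sym gj′) (sym gk′) (All.map (λ {ab} → box⁻ {V} ab) (AllP.map⁻ shaded)))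

module Complement {f g : ℕ → ℕ} {n : ℕ} (g+f : Complementary f g n) {i j k : ℕ} (P : Positions n i j k) where

  open Positions P
  private
    f+g : Complementary g f n
    f+g = Complementary-sym {f} {g} g+f
    gi+fi : g i + f i ≡ suc n
    gi+fi = g+f 1≤i i≤n
    gj+fj : g j + f j ≡ suc n
    gj+fj = g+f 1≤j j≤n
    gk+fk : g k + f k ≡ suc n
    gk+fk = g+f 1≤k k≤n
    fi+gi : f i + g i ≡ suc n
    fi+gi = f+g 1≤i i≤n
    fj+gj : f j + g j ≡ suc n
    fj+gj = f+g 1≤j j≤n
    fk+gk : f k + g k ≡ suc n
    fk+gk = f+g 1≤k k≤n

    column-bounded : ∀ a → at (grid n i j k) (suc (suc a)) ≤ suc n
    column-bounded = grid-bounded P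

  box⁺ : ∀ ab → BoxAt g (grid n i j k) (grid n (g i) (g j) (g k)) ab →
               BoxAt f (grid n i j k) (grid n (f k) (f j) (f i)) (reflectRows ab)
  box⁺ (a , 0) = EmptyBox-complement g+f (column-bounded a) fi+gi (+-identityʳ (suc n))
  box⁺ (a , 1) = EmptyBox-complement g+f (column-bounded a) fj+gj fi+gi
  box⁺ (a , 2) = EmptyBox-complement g+f (column-bounded a) fk+gk fj+gj
  box⁺ (a , 3) = EmptyBox-complement g+f (column-bounded a) refl fk+gk
  box⁺ (a , suc (suc (suc (suc b)))) empty m _ _ _ ()

  box⁻ : ∀ ab → BoxAt f (grid n i j k) (grid n (f k) (f j) (f i)) (reflectRows ab) →
               BoxAt g (grid n i j k) (grid n (g i) (g j) (g k)) ab
  box⁻ (a , 0) = EmptyBox-complement f+g (column-bounded a) refl gi+fi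
  box⁻ (a , 1) = EmptyBox-complement f+g (column-bounded a) gi+fi gj+fj
  box⁻ (a , 2) = EmptyBox-complement f+g (column-bounded a) gj+fj gk+fk
  box⁻ (a , 3) = EmptyBox-complement f+g (column-bounded a) gk+fk (+-identityʳ (suc n))
  box⁻ (a , suc (suc (suc (suc b)))) empty m _ _ _ ()

  occurrence⇔ : ∀ R → Occ123 R g n i j k ⇔ Occ321 (map reflectRows R) f n i j k
  occurrence⇔ R = mk⇔
    (λ ((gi<gj , gj<gk) , shaded) →
      (+≡+⇒<⇒> (trans gj+fj (sym gk+fk)) gj<gk , +≡+⇒<⇒> (trans gi+fi (sym gj+fj)) gi<gj) ,
      AllP.map⁺ (All.map (λ {ab} → box⁺ ab) shaded))
    (λ ((fk<fj , fj<fi) , shaded) →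
      (+≡+⇒<⇒> (trans fj+gj (sym fi+gi)) fj<fi , +≡+⇒<⇒> (trans fk+gk (sym fj+gj)) fk<fj) ,
      All.map (λ {ab} → box⁻ ab) (AllP.map⁻ shaded))

flipTriple : ℕ → List ℕ → List ℕ
flipTriple n (i ∷ j ∷ k ∷ []) = (suc n ∸ k) ∷ (suc n ∸ j) ∷ (suc n ∸ i) ∷ []
flipTriple n t                = t

Positions-flip : ∀ {n i j k} → Positions n i j k → Positions n (suc n ∸ k) (suc n ∸ j) (suc n ∸ i)
Positions-flip {n} P = positions (m<n⇒0<n∸m (s≤s k≤n)) (∸-monoʳ-< j<k (m≤n⇒m≤1+n k≤n))
  (∸-monoʳ-< i<j (m≤n⇒m≤1+n j≤n)) (∸-monoʳ-≤ (suc n) 1≤i)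
  where open Positions P

flipTriple-∈ : ∀ n {t} → t ∈ Triples n → flipTriple n t ∈ Triples n
flipTriple-∈ n t∈ with triple-view n t∈
... | triple P = triple-∈ (Positions-flip P)

flipTriple-involutive : ∀ n {t} → t ∈ Triples n → flipTriple n (flipTriple n t) ≡ t
flipTriple-involutive n t∈ with triple-view n t∈
... | triple P = cong₂ _∷_ (flip-flip i≤n) (cong₂ _∷_ (flip-flip j≤n) (cong₂ _∷_ (flip-flip k≤n) refl))
  where
  open Positions P
  flip-flip : ∀ {n m} → m ≤ n → suc n ∸ (suc n ∸ m) ≡ m
  flip-flip = m∸[m∸n]≡n ∘ m≤n⇒m≤1+n

reverse-Mirrored : ∀ {n π} → IsPermutation n π → Mirrored (at π) (at (reverse π)) (suc n)
reverse-Mirrored {π = π} P {m} {m′} m+m′ 1≤m 1≤m′ =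
  at-reverse π (trans (+-comm m′ m) (trans m+m′ (cong suc (sym (IsPermutation.length≡n P))))) 1≤m′ 1≤m

complement-Complementary : ∀ {n π} → IsPermutation n π → Complementary (at π) (at (complement π)) n
complement-Complementary {n} {π} P {m} 1≤m m≤n = begin
  at (complement π) m + at π m         ≡⟨ cong (_+ at π m) (at-map (suc (length π) ∸_) π 1≤m m≤length) ⟩
  (suc (length π) ∸ at π m) + at π m   ≡⟨ m∸n+n≡m (m≤n⇒m≤1+n πm≤length) ⟩
  suc (length π)                       ≡⟨ cong suc length≡n ⟩
  suc n                                ∎
  where
  open ≡-Reasoning
  open IsPermutation P
  m≤length : m ≤ length π
  m≤length = subst (m ≤_) (sym length≡n) m≤n
  πm≤length : at π m ≤ length π
  πm≤length = subst (at π m ≤_) (sym length≡n) (proj₂ (oneTo-∈⁻ (at-∈-oneTo 1≤m m≤n)))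

occ-reverse : ∀ R {n π} → IsPermutation n π → occ (p123 , R) (reverse π) ≡ occ (p321 , map reflectColumns R) π
occ-reverse R {n} {π} P = begin
  occ (p123 , R) σ
    ≡⟨ occ≡count p123 R σ (length≡n (reverse-IsPermutation P)) ⟩
  count (isOccurrence (p123 , R) σ) (Triples n)
    ≡⟨ count-∘-involution (flipTriple n) (Triples-unique n) (flipTriple-∈ n) (flipTriple-involutive n) _ ⟩
  count (isOccurrence (p123 , R) σ ∘ flipTriple n) (Triples n)
    ≡⟨ count-cong _ _ (Triples n) pointwise ⟩
  count (isOccurrence (p321 , R*) π) (Triples n)
    ≡⟨ occ≡count p321 R* π (length≡n P) ⟨
  occ (p321 , R*) π
    ∎
  where
  open ≡-Reasoning
  open IsPermutation using (length≡n)
  σ : List ℕ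
  σ = reverse π
  R* : List (ℕ × ℕ)
  R* = map reflectColumns R
  pointwise : ∀ {t} → t ∈ Triples n → isOccurrence (p123 , R) σ (flipTriple n t) ≡ isOccurrence (p321 , R*) π t
  pointwise t∈ with triple-view n t∈
  ... | triple Q = T-injective (⇔-sym (occurrence321⇔ R* π (length≡n P) Q) ⇔-∘
      (Reverse.occurrence⇔ (reverse-Mirrored P) Q (Positions-flip Q) (flip+ k≤n) (flip+ j≤n) (flip+ i≤n) R ⇔-∘
       occurrence123⇔ R σ (length≡n (reverse-IsPermutation P)) (Positions-flip Q)))
    where
    open Positions Q
    flip+ : ∀ {m} → m ≤ n → (suc n ∸ m) + m ≡ suc n
    flip+ = m∸n+n≡m ∘ m≤n⇒m≤1+n

occ-complement : ∀ R {n π} → IsPermutation n π → occ (p123 , R) (complement π) ≡ occ (p321 , map reflectRows R) π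
occ-complement R {n} {π} P = begin
  occ (p123 , R) σ
    ≡⟨ occ≡count p123 R σ (length≡n (complement-IsPermutation P)) ⟩
  count (isOccurrence (p123 , R) σ) (Triples n)
    ≡⟨ count-cong _ _ (Triples n) pointwise ⟩
  count (isOccurrence (p321 , R*) π) (Triples n)
    ≡⟨ occ≡count p321 R* π (length≡n P) ⟨
  occ (p321 , R*) π
    ∎
  where
  open ≡-Reasoning
  open IsPermutation using (length≡n)
  σ : List ℕ
  σ = complement π
  R* : List (ℕ × ℕ)
  R* = map reflectRows R
  pointwise : ∀ {t} → t ∈ Triples n → isOccurrence (p123 , R) σ t ≡ isOccurrence (p321 , R*) π t
  pointwise t∈ with triple-view n t∈
  ... | triple Q = T-injective (⇔-sym (occurrence321⇔ R* π (length≡n P) Q) ⇔-∘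
                     (Complement.occurrence⇔ (complement-Complementary P) Q R ⇔-∘
                      occurrence123⇔ R σ (length≡n (complement-IsPermutation P)) Q))

-- The middle letter of a 321-occurrence

EmptyBox-rows⇔ : ∀ {f lo hi u w v} → u ≤ w → w ≤ v → (∀ m → lo < m → m < hi → f m ≢ w) →
  (EmptyBox f lo hi u w × EmptyBox f lo hi w v) ⇔ EmptyBox f lo hi u v
EmptyBox-rows⇔ {f} {lo} {hi} {u} {w} {v} u≤w w≤v avoids = mk⇔ merge split
  where
  merge : EmptyBox f lo hi u w × EmptyBox f lo hi w v → EmptyBox f lo hi u v
  merge (below , above) m lo<m m<hi u<fm fm<v with <-cmp (f m) w
  ... | tri< fm<w _ _ = below m lo<m m<hi u<fm fm<w
  ... | tri≈ _ fm≡w _ = avoids m lo<m m<hi fm≡w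
  ... | tri> _ _ w<fm = above m lo<m m<hi w<fm fm<v
  split : EmptyBox f lo hi u v → EmptyBox f lo hi u w × EmptyBox f lo hi w v
  split empty = (λ m lo<m m<hi u<fm fm<w → empty m lo<m m<hi u<fm (<-≤-trans fm<w w≤v))
              , (λ m lo<m m<hi w<fm fm<v → empty m lo<m m<hi (≤-<-trans u≤w w<fm) fm<v)

EmptyBox-columns⇔ : ∀ {f lo mid hi u v} → lo ≤ mid → mid ≤ hi → ¬ (u < f mid × f mid < v) →
  (EmptyBox f lo mid u v × EmptyBox f mid hi u v) ⇔ EmptyBox f lo hi u v
EmptyBox-columns⇔ {f} {lo} {mid} {hi} {u} {v} lo≤mid mid≤hi outside = mk⇔ merge split
  where
  merge : EmptyBox f lo mid u v × EmptyBox f mid hi u v → EmptyBox f lo hi u v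
  merge (left , right) m lo<m m<hi u<fm fm<v with <-cmp m mid
  ... | tri< m<mid _ _ = left m lo<m m<mid u<fm fm<v
  ... | tri≈ _ refl _  = outside (u<fm , fm<v)
  ... | tri> _ _ mid<m = right m mid<m m<hi u<fm fm<v
  split : EmptyBox f lo hi u v → EmptyBox f lo mid u v × EmptyBox f mid hi u v
  split empty = (λ m lo<m m<mid → empty m lo<m (<-≤-trans m<mid mid≤hi))
              , (λ m mid<m m<hi → empty m (≤-<-trans lo≤mid mid<m) m<hi)

corners : List (ℕ × ℕ)
corners = (0 , 0) ∷ (0 , 3) ∷ (3 , 0) ∷ (3 , 3) ∷ []

Shaded-corners : ∀ {C f n i j j′ k} → C ⊆ corners →
  Shaded C f n i j k (f k) (f j) (f i) → Shaded C f n i j′ k (f k) (f j′) (f i)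
Shaded-corners {C} {f} {n} {i} {j} {j′} {k} C⊆corners shaded =
  All.tabulate (λ ab∈ → corner (C⊆corners ab∈) (All.lookup shaded ab∈))
  where
  corner : ∀ {ab} → ab ∈ corners → BoxAt f (grid n i j k) (grid n (f k) (f j) (f i)) ab →
                                   BoxAt f (grid n i j′ k) (grid n (f k) (f j′) (f i)) ab
  corner (here refl)                         = id
  corner (there (here refl))                 = id
  corner (there (there (here refl)))         = id
  corner (there (there (there (here refl)))) = id

left right low high : List (ℕ × ℕ)
left  = (0 , 1) ∷ (0 , 2) ∷ (1 , 1) ∷ (1 , 2) ∷ (3 , 1) ∷ (3 , 2) ∷ []
right = (0 , 1) ∷ (0 , 2) ∷ (2 , 1) ∷ (2 , 2) ∷ (3 , 1) ∷ (3 , 2) ∷ []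
low   = (1 , 0) ∷ (2 , 0) ∷ (1 , 1) ∷ (2 , 1) ∷ (1 , 3) ∷ (2 , 3) ∷ []
high  = (1 , 0) ∷ (2 , 0) ∷ (1 , 2) ∷ (2 , 2) ∷ (1 , 3) ∷ (2 , 3) ∷ []

module Middles {f : ℕ → ℕ} {n : ℕ}
  (injective : ∀ {p q} → 1 ≤ p → p ≤ n → 1 ≤ q → q ≤ n → f p ≡ f q → p ≡ q) where

  Middle : ℕ → ℕ → ℕ → Set
  Middle i k m = i < m × m < k × f k < f m × f m < f i

  middle? : ∀ i k m → Dec (Middle i k m)
  middle? i k m = (i <? m) ×-dec (m <? k) ×-dec (f k <? f m) ×-dec (f m <? f i)

  middles : ℕ → ℕ → List ℕ
  middles i k = filter (middle? i k) (upTo k)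

  ∈-middles⁺ : ∀ {i k m} → Middle i k m → m ∈ middles i k
  ∈-middles⁺ {i} {k} mid = ∈-filter⁺ (middle? i k) (∈-upTo⁺ (proj₁ (proj₂ mid))) mid

  middles-Middle : ∀ {i k} → All (Middle i k) (middles i k)
  middles-Middle {i} {k} = All.tabulate (proj₂ ∘ ∈-filter⁻ (middle? i k) {xs = upTo k})

  least : ∀ (key : ℕ → ℕ) {i j k} → Middle i k j →
    ∃[ m ] Middle i k m × (∀ {m′} → Middle i k m′ → key m ≤ key m′)
  least key {i} {j} {k} mid = argmin key j (middles i k) , argmin-all key mid middles-Middle ,
    λ mid′ → All.lookup (f[argmin]≤f[xs] j (middles i k)) (∈-middles⁺ mid′)

  greatest : ∀ (key : ℕ → ℕ) {i j k} → Middle i k j →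
    ∃[ m ] Middle i k m × (∀ {m′} → Middle i k m′ → key m′ ≤ key m)
  greatest key {i} {j} {k} mid = argmax key j (middles i k) , argmax-all key mid middles-Middle ,
    λ mid′ → All.lookup (f[xs]≤f[argmax] j (middles i k)) (∈-middles⁺ mid′)

  Positions-middle : ∀ {i j k m} → Positions n i j k → Middle i k m → Positions n i m k
  Positions-middle P (i<m , m<k , _) = positions (Positions.1≤i P) i<m m<k (Positions.k≤n P)

  ColumnBands RowBands : ℕ → ℕ → Set
  ColumnBands i k = EmptyBox f 0 i (f k) (f i) × EmptyBox f k (suc n) (f k) (f i)
  RowBands    i k = EmptyBox f i k 0 (f k) × EmptyBox f i k (f i) (suc n)

  record Selection (L : List (ℕ × ℕ)) (Outer : ℕ → ℕ → Set) (Chosen : ℕ → ℕ → ℕ → Set) : Set where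
    field
      shaded⇔ : ∀ {i j k} → Positions n i j k → Middle i k j →
        Shaded L f n i j k (f k) (f j) (f i) ⇔ (Outer i k × Chosen i j k)
      chosen-unique : ∀ {i j j′ k} → Positions n i j k → Positions n i j′ k → Middle i k j → Middle i k j′ →
        Chosen i j k → Chosen i j′ k → j ≡ j′
      select : ∀ {i j k} → Middle i k j → ∃[ m ] Middle i k m × Chosen i m k

  private
    avoids : ∀ {i j k lo hi} → Positions n i j k → hi ≤ suc n → hi ≤ j ⊎ j ≤ lo →
      ∀ m → lo < m → m < hi → f m ≢ f j
    avoids P hi≤1+n side m lo<m m<hi fm≡fj
      with injective (≤-trans (s≤s z≤n) lo<m) (≤-pred (≤-trans m<hi hi≤1+n))
                     (Positions.1≤j P) (Positions.j≤n P) fm≡fj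
    avoids P hi≤1+n (inj₁ hi≤j) m lo<m m<hi fm≡fj | refl = <⇒≱ m<hi hi≤j
    avoids P hi≤1+n (inj₂ j≤lo) m lo<m m<hi fm≡fj | refl = <⇒≱ lo<m j≤lo

    split-at-value : ∀ {i j k lo hi} → Positions n i j k → Middle i k j → hi ≤ suc n → hi ≤ j ⊎ j ≤ lo →
      (EmptyBox f lo hi (f k) (f j) × EmptyBox f lo hi (f j) (f i)) ⇔ EmptyBox f lo hi (f k) (f i)
    split-at-value P (_ , _ , fk<fj , fj<fi) hi≤1+n side =
      EmptyBox-rows⇔ (<⇒≤ fk<fj) (<⇒≤ fj<fi) (avoids P hi≤1+n side)

    split-at-position : ∀ {i j k u v} → Middle i k j → ¬ (u < f j × f j < v) →
      (EmptyBox f i j u v × EmptyBox f j k u v) ⇔ EmptyBox f i k u v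
    split-at-position (i<j , j<k , _) = EmptyBox-columns⇔ (<⇒≤ i<j) (<⇒≤ j<k)

    column₀ : ∀ {i j k} → Positions n i j k → Middle i k j →
      (EmptyBox f 0 i (f k) (f j) × EmptyBox f 0 i (f j) (f i)) ⇔ EmptyBox f 0 i (f k) (f i)
    column₀ P mid = split-at-value P mid (m≤n⇒m≤1+n (Positions.i≤n P)) (inj₁ (<⇒≤ (Positions.i<j P)))

    column₁ : ∀ {i j k} → Positions n i j k → Middle i k j →
      (EmptyBox f i j (f k) (f j) × EmptyBox f i j (f j) (f i)) ⇔ EmptyBox f i j (f k) (f i)
    column₁ P mid = split-at-value P mid (m≤n⇒m≤1+n (Positions.j≤n P)) (inj₁ ≤-refl)

    column₂ : ∀ {i j k} → Positions n i j k → Middle i k j →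
      (EmptyBox f j k (f k) (f j) × EmptyBox f j k (f j) (f i)) ⇔ EmptyBox f j k (f k) (f i)
    column₂ P mid = split-at-value P mid (m≤n⇒m≤1+n (Positions.k≤n P)) (inj₂ ≤-refl)

    column₃ : ∀ {i j k} → Positions n i j k → Middle i k j →
      (EmptyBox f k (suc n) (f k) (f j) × EmptyBox f k (suc n) (f j) (f i)) ⇔ EmptyBox f k (suc n) (f k) (f i)
    column₃ P mid = split-at-value P mid ≤-refl (inj₂ (<⇒≤ (Positions.j<k P)))

    row₀ : ∀ {i j k} → Middle i k j → (EmptyBox f i j 0 (f k) × EmptyBox f j k 0 (f k)) ⇔ EmptyBox f i k 0 (f k)
    row₀ mid@(_ , _ , fk<fj , _) = split-at-position mid (λ (_ , fj<fk) → <-asym fj<fk fk<fj)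

    row₁ : ∀ {i j k} → Middle i k j →
      (EmptyBox f i j (f k) (f j) × EmptyBox f j k (f k) (f j)) ⇔ EmptyBox f i k (f k) (f j)
    row₁ mid = split-at-position mid (λ (_ , fj<fj) → <-irrefl refl fj<fj)

    row₂ : ∀ {i j k} → Middle i k j →
      (EmptyBox f i j (f j) (f i) × EmptyBox f j k (f j) (f i)) ⇔ EmptyBox f i k (f j) (f i)
    row₂ mid = split-at-position mid (λ (fj<fj , _) → <-irrefl refl fj<fj)

    row₃ : ∀ {i j k} → Middle i k j →
      (EmptyBox f i j (f i) (suc n) × EmptyBox f j k (f i) (suc n)) ⇔ EmptyBox f i k (f i) (suc n)
    row₃ mid@(_ , _ , _ , fj<fi) = split-at-position mid (λ (fi<fj , _) → <-asym fi<fj fj<fi)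

    _∷₂_ : ∀ {A : Set} {P : A → Set} {x y xs} → P x × P y → All P xs → All P (x ∷ y ∷ xs)
    (px , py) ∷₂ pxs = px ∷ py ∷ pxs
    infixr 5 _∷₂_

  leftmost : Selection left ColumnBands (λ i j k → EmptyBox f i j (f k) (f i))
  leftmost = record { shaded⇔ = shaded⇔ ; chosen-unique = chosen-unique ; select = select }
    where
    shaded⇔ : ∀ {i j k} → Positions n i j k → Middle i k j →
      Shaded left f n i j k (f k) (f j) (f i) ⇔ (ColumnBands i k × EmptyBox f i j (f k) (f i))
    shaded⇔ {i} {j} {k} P mid = mk⇔ merge split
      where
      open Equivalence
      merge : Shaded left f n i j k (f k) (f j) (f i) → ColumnBands i k × EmptyBox f i j (f k) (f i)
      merge (B₀₁ ∷ B₀₂ ∷ B₁₁ ∷ B₁₂ ∷ B₃₁ ∷ B₃₂ ∷ []) =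
        (to (column₀ P mid) (B₀₁ , B₀₂) , to (column₃ P mid) (B₃₁ , B₃₂)) , to (column₁ P mid) (B₁₁ , B₁₂)
      split : ColumnBands i k × EmptyBox f i j (f k) (f i) → Shaded left f n i j k (f k) (f j) (f i)
      split ((band₀ , band₃) , box) =
        from (column₀ P mid) band₀ ∷₂ from (column₁ P mid) box ∷₂ from (column₃ P mid) band₃ ∷₂ []
    chosen-unique : ∀ {i j j′ k} → Positions n i j k → Positions n i j′ k → Middle i k j → Middle i k j′ →
      EmptyBox f i j (f k) (f i) → EmptyBox f i j′ (f k) (f i) → j ≡ j′
    chosen-unique _ _ (i<j , _ , fk<fj , fj<fi) (i<j′ , _ , fk<fj′ , fj′<fi) box box′ =
      ≮∧≯⇒≡ (λ j<j′ → box′ _ i<j j<j′ fk<fj fj<fi) (λ j′<j → box _ i<j′ j′<j fk<fj′ fj′<fi)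
    select : ∀ {i j k} → Middle i k j → ∃[ m ] Middle i k m × EmptyBox f i m (f k) (f i)
    select mid with least id mid
    ... | m , mid-m@(_ , m<k , _) , first = m , mid-m ,
      λ m′ i<m′ m′<m fk<fm′ fm′<fi → <⇒≱ m′<m (first (i<m′ , <-trans m′<m m<k , fk<fm′ , fm′<fi))

  rightmost : Selection right ColumnBands (λ i j k → EmptyBox f j k (f k) (f i))
  rightmost = record { shaded⇔ = shaded⇔ ; chosen-unique = chosen-unique ; select = select }
    where
    shaded⇔ : ∀ {i j k} → Positions n i j k → Middle i k j →
      Shaded right f n i j k (f k) (f j) (f i) ⇔ (ColumnBands i k × EmptyBox f j k (f k) (f i))
    shaded⇔ {i} {j} {k} P mid = mk⇔ merge split
      where
      open Equivalence
      merge : Shaded right f n i j k (f k) (f j) (f i) → ColumnBands i k × EmptyBox f j k (f k) (f i)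
      merge (B₀₁ ∷ B₀₂ ∷ B₂₁ ∷ B₂₂ ∷ B₃₁ ∷ B₃₂ ∷ []) =
        (to (column₀ P mid) (B₀₁ , B₀₂) , to (column₃ P mid) (B₃₁ , B₃₂)) , to (column₂ P mid) (B₂₁ , B₂₂)
      split : ColumnBands i k × EmptyBox f j k (f k) (f i) → Shaded right f n i j k (f k) (f j) (f i)
      split ((band₀ , band₃) , box) =
        from (column₀ P mid) band₀ ∷₂ from (column₂ P mid) box ∷₂ from (column₃ P mid) band₃ ∷₂ []
    chosen-unique : ∀ {i j j′ k} → Positions n i j k → Positions n i j′ k → Middle i k j → Middle i k j′ →
      EmptyBox f j k (f k) (f i) → EmptyBox f j′ k (f k) (f i) → j ≡ j′
    chosen-unique _ _ (_ , j<k , fk<fj , fj<fi) (_ , j′<k , fk<fj′ , fj′<fi) box box′ =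
      ≮∧≯⇒≡ (λ j<j′ → box _ j<j′ j′<k fk<fj′ fj′<fi) (λ j′<j → box′ _ j′<j j<k fk<fj fj<fi)
    select : ∀ {i j k} → Middle i k j → ∃[ m ] Middle i k m × EmptyBox f m k (f k) (f i)
    select mid with greatest id mid
    ... | m , mid-m@(i<m , _ , _) , last = m , mid-m ,
      λ m′ m<m′ m′<k fk<fm′ fm′<fi → <⇒≱ m<m′ (last (<-trans i<m m<m′ , m′<k , fk<fm′ , fm′<fi))

  lowest : Selection low RowBands (λ i j k → EmptyBox f i k (f k) (f j))
  lowest = record { shaded⇔ = shaded⇔ ; chosen-unique = chosen-unique ; select = select }
    where
    shaded⇔ : ∀ {i j k} → Positions n i j k → Middle i k j →
      Shaded low f n i j k (f k) (f j) (f i) ⇔ (RowBands i k × EmptyBox f i k (f k) (f j))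
    shaded⇔ {i} {j} {k} P mid = mk⇔ merge split
      where
      open Equivalence
      merge : Shaded low f n i j k (f k) (f j) (f i) → RowBands i k × EmptyBox f i k (f k) (f j)
      merge (B₁₀ ∷ B₂₀ ∷ B₁₁ ∷ B₂₁ ∷ B₁₃ ∷ B₂₃ ∷ []) =
        (to (row₀ mid) (B₁₀ , B₂₀) , to (row₃ mid) (B₁₃ , B₂₃)) , to (row₁ mid) (B₁₁ , B₂₁)
      split : RowBands i k × EmptyBox f i k (f k) (f j) → Shaded low f n i j k (f k) (f j) (f i)
      split ((band₀ , band₃) , box) =
        from (row₀ mid) band₀ ∷₂ from (row₁ mid) box ∷₂ from (row₃ mid) band₃ ∷₂ []
    chosen-unique : ∀ {i j j′ k} → Positions n i j k → Positions n i j′ k → Middle i k j → Middle i k j′ →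
      EmptyBox f i k (f k) (f j) → EmptyBox f i k (f k) (f j′) → j ≡ j′
    chosen-unique P P′ (i<j , j<k , fk<fj , _) (i<j′ , j′<k , fk<fj′ , _) box box′ =
      injective (Positions.1≤j P) (Positions.j≤n P) (Positions.1≤j P′) (Positions.j≤n P′)
        (≮∧≯⇒≡ (λ fj<fj′ → box′ _ i<j j<k fk<fj fj<fj′) (λ fj′<fj → box _ i<j′ j′<k fk<fj′ fj′<fj))
    select : ∀ {i j k} → Middle i k j → ∃[ m ] Middle i k m × EmptyBox f i k (f k) (f m)
    select mid with least f mid
    ... | m , mid-m@(_ , _ , _ , fm<fi) , lowest = m , mid-m ,
      λ m′ i<m′ m′<k fk<fm′ fm′<fm → <⇒≱ fm′<fm (lowest (i<m′ , m′<k , fk<fm′ , <-trans fm′<fm fm<fi))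

  highest : Selection high RowBands (λ i j k → EmptyBox f i k (f j) (f i))
  highest = record { shaded⇔ = shaded⇔ ; chosen-unique = chosen-unique ; select = select }
    where
    shaded⇔ : ∀ {i j k} → Positions n i j k → Middle i k j →
      Shaded high f n i j k (f k) (f j) (f i) ⇔ (RowBands i k × EmptyBox f i k (f j) (f i))
    shaded⇔ {i} {j} {k} P mid = mk⇔ merge split
      where
      open Equivalence
      merge : Shaded high f n i j k (f k) (f j) (f i) → RowBands i k × EmptyBox f i k (f j) (f i)
      merge (B₁₀ ∷ B₂₀ ∷ B₁₂ ∷ B₂₂ ∷ B₁₃ ∷ B₂₃ ∷ []) =
        (to (row₀ mid) (B₁₀ , B₂₀) , to (row₃ mid) (B₁₃ , B₂₃)) , to (row₂ mid) (B₁₂ , B₂₂)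
      split : RowBands i k × EmptyBox f i k (f j) (f i) → Shaded high f n i j k (f k) (f j) (f i)
      split ((band₀ , band₃) , box) =
        from (row₀ mid) band₀ ∷₂ from (row₂ mid) box ∷₂ from (row₃ mid) band₃ ∷₂ []
    chosen-unique : ∀ {i j j′ k} → Positions n i j k → Positions n i j′ k → Middle i k j → Middle i k j′ →
      EmptyBox f i k (f j) (f i) → EmptyBox f i k (f j′) (f i) → j ≡ j′
    chosen-unique P P′ (i<j , j<k , _ , fj<fi) (i<j′ , j′<k , _ , fj′<fi) box box′ =
      injective (Positions.1≤j P) (Positions.j≤n P) (Positions.1≤j P′) (Positions.j≤n P′)
        (≮∧≯⇒≡ (λ fj<fj′ → box _ i<j′ j′<k fj<fj′ fj′<fi) (λ fj′<fj → box′ _ i<j j<k fj′<fj fj<fi))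
    select : ∀ {i j k} → Middle i k j → ∃[ m ] Middle i k m × EmptyBox f i k (f m) (f i)
    select mid with greatest f mid
    ... | m , mid-m@(_ , _ , fk<fm , _) , highest = m , mid-m ,
      λ m′ i<m′ m′<k fm<fm′ fm′<fi → <⇒≱ fm<fm′ (highest (i<m′ , m′<k , <-trans fk<fm fm<fm′ , fm′<fi))

outerLetters : List ℕ → List ℕ
outerLetters (i ∷ j ∷ k ∷ []) = i ∷ k ∷ []
outerLetters t                = t

module _ {n : ℕ} {π : List ℕ} (P : IsPermutation n π) where
  open IsPermutation P using (length≡n; at-injective)
  open Middles {at π} {n} at-injective

  private
    describe : ∀ {L Outer Chosen C R i j k} → Selection L Outer Chosen → C ++ L ⊆ R → Positions n i j k →
      T (isOccurrence (p321 , R) π (i ∷ j ∷ k ∷ [])) →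
      Middle i k j × Shaded C (at π) n i j k (at π k) (at π j) (at π i) × Outer i k × Chosen i j k
    describe {C = C} {R} {i} {j} {k} S CL⊆R Q occ with Equivalence.to (occurrence321⇔ R π length≡n Q) occ
    ... | (fk<fj , fj<fi) , shaded with AllP.++⁻ C (Shaded-⊆ CL⊆R shaded)
    ... | shadedC , shadedL = mid , shadedC , Equivalence.to (Selection.shaded⇔ S Q mid) shadedL
      where
      mid : Middle i k j
      mid = Positions.i<j Q , Positions.j<k Q , fk<fj , fj<fi

    assemble : ∀ {L Outer Chosen C R i j j′ k} → Selection L Outer Chosen → C ⊆ corners → R ⊆ C ++ L →
      Positions n i j k → Middle i k j → Shaded C (at π) n i j′ k (at π k) (at π j′) (at π i) →
      Outer i k → Chosen i j k → T (isOccurrence (p321 , R) π (i ∷ j ∷ k ∷ []))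
    assemble {R = R} S C⊆corners R⊆CL Q mid@(_ , _ , fk<fj , fj<fi) shadedC outer chosen =
      Equivalence.from (occurrence321⇔ R π length≡n Q) ((fk<fj , fj<fi) , Shaded-⊆ R⊆CL
        (AllP.++⁺ (Shaded-corners C⊆corners shadedC) (Equivalence.from (Selection.shaded⇔ S Q mid) (outer , chosen))))

    middle-unique : ∀ {L Outer Chosen C R} → Selection L Outer Chosen → C ++ L ⊆ R →
      InjectiveOn (isOccurrence (p321 , R) π) outerLetters (Triples n)
    middle-unique S CL⊆R t∈ t′∈ occ occ′ same-outer with triple-view n t∈ | triple-view n t′∈
    ... | triple Q | triple Q′ with same-outer
    ... | refl with describe S CL⊆R Q occ | describe S CL⊆R Q′ occ′
    ... | mid , _ , _ , chosen | mid′ , _ , _ , chosen′ =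
      cong (λ j → _ ∷ j ∷ _ ∷ []) (Selection.chosen-unique S Q Q′ mid mid′ chosen chosen′)

    move : ∀ {L₁ L₂ Outer Chosen₁ Chosen₂ C R₁ R₂} →
      Selection L₁ Outer Chosen₁ → Selection L₂ Outer Chosen₂ → C ⊆ corners → C ++ L₁ ⊆ R₁ → R₂ ⊆ C ++ L₂ →
      KeysCovered (isOccurrence (p321 , R₁) π) outerLetters (isOccurrence (p321 , R₂) π) outerLetters (Triples n)
    move S₁ S₂ C⊆corners CL⊆R₁ R₂⊆CL t∈ occ with triple-view n t∈
    ... | triple {i} {j} {k} Q with describe S₁ CL⊆R₁ Q occ
    ... | mid , shadedC , outer , _ with Selection.select S₂ mid
    ... | m , mid-m , chosen =
      i ∷ m ∷ k ∷ [] , triple-∈ Q′ , assemble S₂ C⊆corners R₂⊆CL Q′ mid-m shadedC outer chosen , refl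
      where
      Q′ : Positions n i m k
      Q′ = Positions-middle Q mid-m

  occ321-≡-by-selection : ∀ {L₁ L₂ Outer Chosen₁ Chosen₂} →
    Selection L₁ Outer Chosen₁ → Selection L₂ Outer Chosen₂ →
    ∀ {C R₁ R₂} → C ⊆ corners → R₁ ⊆ C ++ L₁ → C ++ L₁ ⊆ R₁ → R₂ ⊆ C ++ L₂ → C ++ L₂ ⊆ R₂ →
    occ (p321 , R₁) π ≡ occ (p321 , R₂) π
  occ321-≡-by-selection S₁ S₂ {C} {R₁} {R₂} C⊆corners R₁⊆CL₁ CL₁⊆R₁ R₂⊆CL₂ CL₂⊆R₂ = begin
    occ (p321 , R₁) π
      ≡⟨ occ≡count p321 R₁ π length≡n ⟩
    count (isOccurrence (p321 , R₁) π) (Triples n)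
      ≡⟨ count-≡-by-keys _ _ outerLetters outerLetters (Triples-unique n)
           (middle-unique S₁ CL₁⊆R₁) (middle-unique S₂ CL₂⊆R₂)
           (move S₁ S₂ C⊆corners CL₁⊆R₁ R₂⊆CL₂) (move S₂ S₁ C⊆corners CL₂⊆R₂ R₁⊆CL₁) ⟩
    count (isOccurrence (p321 , R₂) π) (Triples n)
      ≡⟨ occ≡count p321 R₂ π length≡n ⟨
    occ (p321 , R₂) π
      ∎
    where open ≡-Reasoning

  occ321-left≡right : ∀ {C R₁ R₂} → C ⊆ corners →
    R₁ ⊆ C ++ left → C ++ left ⊆ R₁ → R₂ ⊆ C ++ right → C ++ right ⊆ R₂ →
    occ (p321 , R₁) π ≡ occ (p321 , R₂) π
  occ321-left≡right = occ321-≡-by-selection leftmost rightmost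

  occ321-low≡high : ∀ {C R₁ R₂} → C ⊆ corners →
    R₁ ⊆ C ++ low → C ++ low ⊆ R₁ → R₂ ⊆ C ++ high → C ++ high ⊆ R₂ →
    occ (p321 , R₁) π ≡ occ (p321 , R₂) π
  occ321-low≡high = occ321-≡-by-selection lowest highest

-- Joint equidistribution

all-cong-⊆ : ∀ {A : Set} (p : A → Bool) {xs ys} → xs ⊆ ys → ys ⊆ xs → all p xs ≡ all p ys
all-cong-⊆ p {xs} {ys} xs⊆ys ys⊆xs = T-injective (mk⇔ (transfer xs⊆ys ys⊆xs) (transfer ys⊆xs xs⊆ys))
  where
  transfer : ∀ {us vs} → us ⊆ vs → vs ⊆ us → T (all p us) → T (all p vs)
  transfer {us} {vs} _ vs⊆us all-us = all⁻ p (All.tabulate (All.lookup (all⁺ p us all-us) ∘ vs⊆us))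

occ-cong-⊆ : ∀ τ {R R′} π → R ⊆ R′ → R′ ⊆ R → occ (τ , R) π ≡ occ (τ , R′) π
occ-cong-⊆ τ {R} {R′} π R⊆R′ R′⊆R = count-cong _ _ (choose (length τ) (oneTo (length π))) λ {t} _ →
  cong (orderIso (map (at π) t) τ ∧_) (all-cong-⊆ (emptyBoxᵇ π (I t) (V t)) R⊆R′ R′⊆R)
  where
  I V : List ℕ → List ℕ
  I t = (0 ∷ t) ++ (suc (length π) ∷ [])
  V t = (0 ∷ sort (map (at π) t)) ++ (suc (length π) ∷ [])

jointlyEquidistributed-by-involution : ∀ q₁ q₂ (g : List ℕ → List ℕ) →
  (∀ {n π} → IsPermutation n π → IsPermutation n (g π)) → (∀ {n π} → IsPermutation n π → g (g π) ≡ π) →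
  (∀ {n π} → IsPermutation n π → occ q₁ (g π) ≡ occ q₂ π) → JointlyEquidistributed q₁ q₂
jointlyEquidistributed-by-involution q₁ q₂ g g-perm g-invol occ₁∘g n _ k ℓ = begin
  count (counts k ℓ) (S n)     ≡⟨ count-∘-involution g (S-unique n) (S-∈⁺ n ∘ g-perm ∘ S-∈⁻ n) (g-invol ∘ S-∈⁻ n) _ ⟩
  count (counts k ℓ ∘ g) (S n) ≡⟨ count-cong _ _ (S n) (swapped ∘ S-∈⁻ n) ⟩
  count (counts ℓ k) (S n)     ∎
  where
  open ≡-Reasoning
  counts : ℕ → ℕ → List ℕ → Bool
  counts k ℓ π = (occ q₁ π ≡ᵇ k) ∧ (occ q₂ π ≡ᵇ ℓ)
  swapped : ∀ {π} → IsPermutation n π → counts k ℓ (g π) ≡ counts ℓ k π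
  swapped {π} P = begin
    (occ q₁ (g π) ≡ᵇ k) ∧ (occ q₂ (g π) ≡ᵇ ℓ)
      ≡⟨ cong₂ (λ a b → (a ≡ᵇ k) ∧ (b ≡ᵇ ℓ)) (occ₁∘g P) occ₂∘g ⟩
    (occ q₂ π ≡ᵇ k) ∧ (occ q₁ π ≡ᵇ ℓ)
      ≡⟨ ∧-comm (occ q₂ π ≡ᵇ k) (occ q₁ π ≡ᵇ ℓ) ⟩
    (occ q₁ π ≡ᵇ ℓ) ∧ (occ q₂ π ≡ᵇ k)
      ∎
    where
    occ₂∘g : occ q₂ (g π) ≡ occ q₁ π
    occ₂∘g = trans (sym (occ₁∘g (g-perm P))) (cong (occ q₁) (g-invol P))

decided : ∀ {xs ys : List (ℕ × ℕ)} {_ : True (xs ⊆? ys)} → xs ⊆ ys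
decided {_} {_} {xs⊆ys} = toWitness xs⊆ys

jointlyEquidistributed-by-reverse : ∀ R R* → R* ⊆ map reflectColumns R → map reflectColumns R ⊆ R* →
  (∀ {n π} → IsPermutation n π → occ (p321 , R*) π ≡ occ (p321 , R) π) →
  JointlyEquidistributed (p123 , R) (p321 , R)
jointlyEquidistributed-by-reverse R R* R*⊆ ⊆R* same =
  jointlyEquidistributed-by-involution (p123 , R) (p321 , R) reverse
  reverse-IsPermutation (λ {_} {π} _ → reverse-involutive π)
  (λ {_} {π} P → trans (occ-reverse R P) (trans (occ-cong-⊆ p321 π ⊆R* R*⊆) (same P)))

jointlyEquidistributed-by-complement : ∀ R R* → R* ⊆ map reflectRows R → map reflectRows R ⊆ R* →
  (∀ {n π} → IsPermutation n π → occ (p321 , R*) π ≡ occ (p321 , R) π) →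
  JointlyEquidistributed (p123 , R) (p321 , R)
jointlyEquidistributed-by-complement R R* R*⊆ ⊆R* same =
  jointlyEquidistributed-by-involution (p123 , R) (p321 , R) complement
  complement-IsPermutation complement-involutive
  (λ {_} {π} P → trans (occ-complement R P) (trans (occ-cong-⊆ p321 π ⊆R* R*⊆) (same P)))

lowerCorners upperCorners leftCorners rightCorners : List (ℕ × ℕ)
lowerCorners = (0 , 0) ∷ (3 , 0) ∷ []
upperCorners = (0 , 3) ∷ (3 , 3) ∷ []
leftCorners  = (0 , 0) ∷ (0 , 3) ∷ []
rightCorners = (3 , 0) ∷ (3 , 3) ∷ []

occ321-A25≡A32 : ∀ {n π} → IsPermutation n π → occ (p321 , A25) π ≡ occ (p321 , A32) π
occ321-A25≡A32 P = occ321-left≡right P {lowerCorners} {A25} {A32} decided decided decided decided decided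

occ321-A28≡A27 : ∀ {n π} → IsPermutation n π → occ (p321 , A28) π ≡ occ (p321 , A27) π
occ321-A28≡A27 P = occ321-left≡right P {upperCorners} {A28} {A27} decided decided decided decided decided

occ321-A30≡A29 : ∀ {n π} → IsPermutation n π → occ (p321 , A30) π ≡ occ (p321 , A29) π
occ321-A30≡A29 P = occ321-low≡high P {leftCorners} {A30} {A29} decided decided decided decided decided

occ321-A26≡A31 : ∀ {n π} → IsPermutation n π → occ (p321 , A26) π ≡ occ (p321 , A31) π
occ321-A26≡A31 P = occ321-low≡high P {rightCorners} {A26} {A31} decided decided decided decided decided

theorem3p3 : (R : List (ℕ × ℕ)) → R ∈ theShadings →
    JointlyEquidistributed (p123 , R) (p321 , R)
theorem3p3 _ (here refl) =
  jointlyEquidistributed-by-reverse A25 A32 decided decided (λ P → sym (occ321-A25≡A32 P))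
theorem3p3 _ (there (here refl)) =
  jointlyEquidistributed-by-complement A26 A31 decided decided (λ P → sym (occ321-A26≡A31 P))
theorem3p3 _ (there (there (here refl))) =
  jointlyEquidistributed-by-reverse A27 A28 decided decided occ321-A28≡A27
theorem3p3 _ (there (there (there (here refl)))) =
  jointlyEquidistributed-by-reverse A28 A27 decided decided (λ P → sym (occ321-A28≡A27 P))
theorem3p3 _ (there (there (there (there (here refl))))) =
  jointlyEquidistributed-by-complement A29 A30 decided decided occ321-A30≡A29
theorem3p3 _ (there (there (there (there (there (here refl)))))) =
  jointlyEquidistributed-by-complement A30 A29 decided decided (λ P → sym (occ321-A30≡A29 P))
theorem3p3 _ (there (there (there (there (there (there (here refl))))))) =
  jointlyEquidistributed-by-complement A31 A26 decided decided occ321-A26≡A31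
theorem3p3 _ (there (there (there (there (there (there (there (here refl)))))))) =
  jointlyEquidistributed-by-reverse A32 A25 decided decided occ321-A25≡A32
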